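{- Let $G=(V,E)$ be a finite simple bipartite graph, and let $\Psi(G)$ be the family of all local maximum stable sets of $G$. Then $(V,\Psi(G))$ is a greedoid if and only if every maximum matching of $G$ is uniquely restricted.
   Context: For $A\subseteq V$, $N(A)=\{v\in V-A: v \text{ has a neighbor in } A\}$ and $N[A]=A\cup N(A)$; $G[X]$ is the subgraph induced by $X$. A stable set is a set of pairwise non-adjacent vertices; a maximum stable set is a stable set of maximum cardinality. A set $A\subseteq V$ is a local maximum stable set of $G$ if $A$ is a maximum stable set of $G[N[A]]$; $\Psi(G)$ denotes the family of all such sets. A matching $M$ is uniquely restricted if $M$ is the unique perfect matching of the subgraph induced by the set of vertices saturated by $M$. A greedoid is a pair $(E,\mathcal F)$ with $\mathcal F\subseteq 2^E$ such that (Accessibility) every non-empty $X\in\mathcal F$ contains some $x$ with $X-\{x\}\in\mathcal F$, and (Exchange) for $X,Y\in\mathcal F$ with $|X|=|Y|+1$ there is $x\in X-Y$ with $Y\cup\{x\}\in\mathcal F$. -}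

module Defs where

open import Data.Nat using (ℕ; suc; _≤_)
open import Data.Bool using (Bool; true; false)
open import Data.Fin using (Fin)
open import Data.Fin.Subset using (Subset; _∈_; _∉_; _⊆_; _-_; _∪_; ⁅_⁆; ∣_∣; Nonempty)
open import Data.List using (List; []; _∷_; length; concatMap)
open import Data.List.Relation.Unary.All using (All)
open import Data.List.Relation.Unary.Unique.Propositional using (Unique)
import Data.List.Membership.Propositional as LM
open import Data.Product using (Σ; ∃; _×_; _,_)
open import Data.Sum using (_⊎_)
open import Relation.Binary.PropositionalEquality using (_≡_; _≢_)
open import Function.Bundles using (_⇔_)

record Graph (n : ℕ) : Set where
  field
    adj     : Fin n → Fin n → Bool
    adj-sym : ∀ u v → adj u v ≡ adj v u
    irrefl  : ∀ v → adj v v ≡ false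
open Graph public

module _ {n : ℕ} (G : Graph n) where

  Adj : Fin n → Fin n → Set
  Adj u v = adj G u v ≡ true

  Bipartite : Set
  Bipartite = Σ (Fin n → Bool) λ c → ∀ u v → Adj u v → c u ≢ c v

  InClosedNbhd : Subset n → Fin n → Set
  InClosedNbhd A v = v ∈ A ⊎ ∃ λ u → u ∈ A × Adj u v

  Stable : Subset n → Set
  Stable A = ∀ u v → u ∈ A → v ∈ A → adj G u v ≡ false

  -- A is a local maximum stable set: A is a maximum stable set of G[N[A]]
  -- (A ⊆ N[A] holds automatically; stable sets of G[N[A]] are the
  --  stable sets of G contained in N[A]).
  LocalMaxStable : Subset n → Set
  LocalMaxStable A =
    Stable A × (∀ B → Stable B → (∀ v → v ∈ B → InClosedNbhd A v) → ∣ B ∣ ≤ ∣ A ∣)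

  Ψ : Subset n → Set
  Ψ = LocalMaxStable

  Endpoints : List (Fin n × Fin n) → List (Fin n)
  Endpoints = concatMap (λ { (u , v) → u ∷ v ∷ [] })

  IsMatching : List (Fin n × Fin n) → Set
  IsMatching M = All (λ { (u , v) → Adj u v }) M × Unique (Endpoints M)

  IsMaximumMatching : List (Fin n × Fin n) → Set
  IsMaximumMatching M =
    IsMatching M × (∀ M' → IsMatching M' → length M' ≤ length M)

  EdgeIn : Fin n × Fin n → List (Fin n × Fin n) → Set
  EdgeIn (u , v) M = (u , v) LM.∈ M ⊎ (v , u) LM.∈ M

  SameEdgeSet : List (Fin n × Fin n) → List (Fin n × Fin n) → Set
  SameEdgeSet M M' = ∀ u v → EdgeIn (u , v) M ⇔ EdgeIn (u , v) M'

  -- M is uniquely restricted: every perfect matching of G[V(M)]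
  -- (i.e. every matching of G saturating exactly V(M)) equals M.
  UniquelyRestricted : List (Fin n × Fin n) → Set
  UniquelyRestricted M =
    IsMatching M ×
    (∀ M' → IsMatching M' →
       (∀ v → (v LM.∈ Endpoints M') ⇔ (v LM.∈ Endpoints M)) →
       SameEdgeSet M' M)

record IsGreedoid {n : ℕ} (F : Subset n → Set) : Set where
  field
    accessible : ∀ X → F X → Nonempty X → ∃ λ x → x ∈ X × F (X - x)
    exchange   : ∀ X Y → F X → F Y → ∣ X ∣ ≡ suc ∣ Y ∣ →
                 ∃ λ x → x ∈ X × x ∉ Y × F (Y ∪ ⁅ x ⁆)

-- For a stable set S, being a local maximum stable set is
-- equivalent to minimising the surplus |N(T)| - |T| over T ⊆ S (a stable subset of
-- N[S] is cut into its two colour classes), and it follows whenever N(S) can be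
-- matched into S; by Hall's theorem the converse holds as well. König-Egerváry
-- supplies a stable A with |M| + |A| = |V| for every maximum matching M.
--
-- Greedoid ⇒ uniquely restricted: S = A ∩ V(M) is in Ψ with |N(S)| = |S|. Peeling S
-- down by accessibility pins down, one vertex at a time, the partner in S of every
-- vertex of N(S) = V ∖ A, so a matching on V(M) has no choice but to be M.
--
-- Uniquely restricted ⇒ greedoid: a matching of N(S) into S (S ∈ Ψ) extends to a
-- maximum matching, hence is determined by its image. For Y ⊆ S in Ψ this lets one
-- remove some x ∈ S ∖ Y from S within Ψ, since otherwise a second such matching with
-- the same image exists. This gives accessibility (Y = ∅), and exchange after first
-- enlarging Y by a suitable piece of X ∖ N[Y].

module Submission where

open import Defs
open import Data.Nat using (ℕ; zero; suc; _+_; _∸_; _≤_; _<_; z≤n; s≤s)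
open import Data.Nat.Properties
open import Data.Nat.Tactic.RingSolver using (solve-∀)
open import Algebra.Properties.CommutativeSemigroup +-commutativeSemigroup using (interchange)
open import Data.Bool using (Bool; true; false; _∧_; _∨_; not; if_then_else_)
import Data.Bool.Properties as BoolP
open import Algebra.Bundles using (CommutativeMonoid)
open import Algebra.Properties.CommutativeSemigroup (CommutativeMonoid.commutativeSemigroup BoolP.∧-commutativeMonoid)
  using () renaming (xy∙z≈xz∙y to ∧-xy∙z≈xz∙y)
open import Data.Fin using (Fin; zero; suc)
import Data.Fin.Properties as FinP
open import Data.Fin.Subset using (Subset; ⁅_⁆; ∣_∣; Nonempty; _─_) renaming (_∈_ to _∈s_; _∉_ to _∉s_; _-_ to _-s_; _∪_ to _∪s_; ⊥ to ⊥s)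
open import Data.Product using (Σ; ∃; _×_; _,_; proj₁; proj₂)
open import Data.Sum using (_⊎_; inj₁; inj₂)
open import Data.Empty using (⊥; ⊥-elim)
open import Data.List using (List; []; _∷_; _++_; map; length; filter; allFin)
open import Data.List.Properties using (length-map)
open import Data.List.Relation.Unary.Any using (here; there)
import Data.List.Relation.Unary.Any as AnyM
open import Data.List.Relation.Unary.All using (All; []; _∷_)
import Data.List.Relation.Unary.All as AllM
open import Data.List.Relation.Unary.AllPairs using ([]; _∷_)
open import Data.List.Relation.Unary.Unique.Propositional using (Unique)
open import Data.List.Membership.Propositional using (_∈_; lose)
open import Data.List.Membership.Propositional.Properties using (∈-map⁺; ∈-++⁺ˡ; ∈-++⁺ʳ; ∈-filter⁺; ∈-filter⁻; ∈-allFin)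
import Data.List.Relation.Unary.Unique.Propositional.Properties as Unique
open import Data.Vec using ([]; _∷_; lookup; tabulate)
import Data.Vec.Properties as VecP
open import Relation.Nullary using (¬_; Dec; yes; no)
open import Relation.Nullary.Decidable using (_×-dec_; _→-dec_; ¬?)
open import Relation.Binary.PropositionalEquality
open import Function.Base using (id)
open import Function.Bundles using (_⇔_; mk⇔; Equivalence)

true≢false : true ≡ false → ⊥
true≢false ()

∧-elimˡ : ∀ {a b} → a ∧ b ≡ true → a ≡ true
∧-elimˡ {true} p = refl

∧-elimʳ : ∀ {a b} → a ∧ b ≡ true → b ≡ true
∧-elimʳ {true} p = p

∧-intro : ∀ {a b} → a ≡ true → b ≡ true → a ∧ b ≡ true
∧-intro refl refl = refl

∨-elim : ∀ {a b} → a ∨ b ≡ true → a ≡ true ⊎ b ≡ true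
∨-elim {true} p = inj₁ refl
∨-elim {false} p = inj₂ p

∨-introˡ : ∀ {a b} → a ≡ true → a ∨ b ≡ true
∨-introˡ refl = refl

∨-introʳ : ∀ {a b} → b ≡ true → a ∨ b ≡ true
∨-introʳ {true} p = refl
∨-introʳ {false} p = p

not-elim : ∀ {a} → not a ≡ true → a ≡ false
not-elim {false} p = refl

not-intro : ∀ {a} → a ≡ false → not a ≡ true
not-intro refl = refl

true-false-absurd : ∀ {a} → a ≡ true → a ≡ false → ⊥
true-false-absurd refl ()

true-or-false : ∀ (a : Bool) → a ≡ true ⊎ a ≡ false
true-or-false true = inj₁ refl
true-or-false false = inj₂ refl

eqF : ∀ {n} → Fin n → Fin n → Bool
eqF zero zero = true
eqF zero (suc j) = false
eqF (suc i) zero = false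
eqF (suc i) (suc j) = eqF i j

eqF⇒≡ : ∀ {n} {i j : Fin n} → eqF i j ≡ true → i ≡ j
eqF⇒≡ {i = zero} {zero} p = refl
eqF⇒≡ {i = suc i} {suc j} p = cong suc (eqF⇒≡ p)

eqF-refl : ∀ {n} (i : Fin n) → eqF i i ≡ true
eqF-refl zero = refl
eqF-refl (suc i) = eqF-refl i

≢⇒eqF-false : ∀ {n} {i j : Fin n} → ¬ i ≡ j → eqF i j ≡ false
≢⇒eqF-false {i = i} {j} ne with eqF i j in eq
... | true = ⊥-elim (ne (eqF⇒≡ eq))
... | false = refl

-- Vertex sets as characteristic functions. Without function extensionality two such
-- sets are only pointwise equal (_≐_), so predicates on them are transported along _≐_.
BSet : ℕ → Set
BSet n = Fin n → Bool

module _ {n : ℕ} where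
  infixr 7 _∩b_
  infixr 6 _∪b_
  _∩b_ : BSet n → BSet n → BSet n
  (A ∩b B) i = A i ∧ B i
  _∪b_ : BSet n → BSet n → BSet n
  (A ∪b B) i = A i ∨ B i
  _∖b_ : BSet n → BSet n → BSet n
  (A ∖b B) i = A i ∧ not (B i)
  ∁b : BSet n → BSet n
  ∁b A i = not (A i)
  ∅b : BSet n
  ∅b i = false
  fullb : BSet n
  fullb i = true
  ⁅_⁆b : Fin n → BSet n
  ⁅ x ⁆b i = eqF i x
  _-b_ : BSet n → Fin n → BSet n
  (A -b x) i = A i ∧ not (eqF i x)

  _≐_ : BSet n → BSet n → Set
  A ≐ B = ∀ i → A i ≡ B i

  _⊆b_ : BSet n → BSet n → Set
  A ⊆b B = ∀ i → A i ≡ true → B i ≡ true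

  _⊆b?_ : ∀ (A B : BSet n) → Dec (A ⊆b B)
  _⊆b?_ A B = FinP.all? (λ i → (A i BoolP.≟ true) →-dec (B i BoolP.≟ true))

  piecewise : BSet n → (Fin n → Fin n) → (Fin n → Fin n) → Fin n → Fin n
  piecewise P f g v = if P v then f v else g v

  piecewise-true : ∀ P f g v → P v ≡ true → piecewise P f g v ≡ f v
  piecewise-true P f g v p rewrite p = refl

  piecewise-false : ∀ P f g v → P v ≡ false → piecewise P f g v ≡ g v
  piecewise-false P f g v p rewrite p = refl

bit : Bool → ℕ
bit true = 1
bit false = 0

size : ∀ {n} → BSet n → ℕ
size {zero} A = 0
size {suc n} A = bit (A zero) + size (λ i → A (suc i))

size-cong : ∀ {n} (A B : BSet n) → A ≐ B → size A ≡ size B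
size-cong {zero} A B e = refl
size-cong {suc n} A B e = cong₂ _+_ (cong bit (e zero)) (size-cong _ _ (λ i → e (suc i)))

bit-mono : ∀ {a b} → (a ≡ true → b ≡ true) → bit a ≤ bit b
bit-mono {false} h = z≤n
bit-mono {true} h rewrite h refl = s≤s z≤n

size-mono : ∀ {n} (A B : BSet n) → A ⊆b B → size A ≤ size B
size-mono {zero} A B h = z≤n
size-mono {suc n} A B h = +-mono-≤ (bit-mono (h zero)) (size-mono _ _ (λ i → h (suc i)))

bit-split : ∀ a p → bit a ≡ bit (a ∧ p) + bit (a ∧ not p)
bit-split true true = refl
bit-split true false = refl
bit-split false p = refl

size-split : ∀ {n} (A P : BSet n) → size A ≡ size (A ∩b P) + size (A ∖b P)
size-split {zero} A P = refl
size-split {suc n} A P =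
  trans (cong₂ _+_ (bit-split (A zero) (P zero)) (size-split (λ i → A (suc i)) (λ i → P (suc i))))
        (interchange (bit (A zero ∧ P zero)) (bit (A zero ∧ not (P zero))) _ _)

bit-∪-∩ : ∀ a b → bit (a ∨ b) + bit (a ∧ b) ≡ bit a + bit b
bit-∪-∩ true true = refl
bit-∪-∩ true false = refl
bit-∪-∩ false b = +-identityʳ (bit b)

size-∪-∩ : ∀ {n} (A B : BSet n) → size (A ∪b B) + size (A ∩b B) ≡ size A + size B
size-∪-∩ {zero} A B = refl
size-∪-∩ {suc n} A B =
  trans (interchange (bit (A zero ∨ B zero)) _ (bit (A zero ∧ B zero)) _)
   (trans (cong₂ _+_ (bit-∪-∩ (A zero) (B zero)) (size-∪-∩ (λ i → A (suc i)) (λ i → B (suc i))))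
     (interchange (bit (A zero)) (bit (B zero)) _ _))

size-empty : ∀ {n} (A : BSet n) → (∀ i → A i ≡ false) → size A ≡ 0
size-empty {zero} A h = refl
size-empty {suc n} A h rewrite h zero = size-empty _ (λ i → h (suc i))

size≡0⇒empty : ∀ {n} (A : BSet n) → size A ≡ 0 → ∀ i → A i ≡ false
size≡0⇒empty {suc n} A h i with A zero in e
size≡0⇒empty {suc n} A h zero | false = e
size≡0⇒empty {suc n} A h (suc i) | false = size≡0⇒empty (λ j → A (suc j)) h i

size>0⇒nonempty : ∀ {n} (A : BSet n) → 0 < size A → ∃ λ i → A i ≡ true
size>0⇒nonempty {suc n} A h with A zero in e
... | true = zero , e
... | false = let (i , p) = size>0⇒nonempty (λ j → A (suc j)) h in suc i , p

size≤n : ∀ {n} (A : BSet n) → size A ≤ n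
size≤n {zero} A = z≤n
size≤n {suc n} A with A zero
... | true = s≤s (size≤n _)
... | false = m≤n⇒m≤1+n (size≤n _)

bit-complement : ∀ a → bit a + bit (not a) ≡ 1
bit-complement true = refl
bit-complement false = refl

size-complement : ∀ {n} (A : BSet n) → size A + size (∁b A) ≡ n
size-complement {zero} A = refl
size-complement {suc n} A =
  trans (interchange (bit (A zero)) _ (bit (not (A zero))) _)
    (cong₂ _+_ (bit-complement (A zero)) (size-complement (λ i → A (suc i))))

size-singleton : ∀ {n} (x : Fin n) → size ⁅ x ⁆b ≡ 1
size-singleton {suc n} zero = cong suc (size-empty {n} _ (λ i → refl))
size-singleton {suc n} (suc x) = size-singleton x

size-∅ : ∀ {n} → size (∅b {n}) ≡ 0
size-∅ {n} = size-empty {n} _ (λ i → refl)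

size-disjoint-∪ : ∀ {n} (A B : BSet n) → (∀ i → A i ≡ true → B i ≡ true → ⊥) →
           size (A ∪b B) ≡ size A + size B
size-disjoint-∪ A B d = trans (sym (+-identityʳ _))
  (trans (cong (size (A ∪b B) +_) (sym (size-empty (A ∩b B) h))) (size-∪-∩ A B))
  where
  h : ∀ i → A i ∧ B i ≡ false
  h i with A i in ea | B i in eb
  ... | true | true = ⊥-elim (d i ea eb)
  ... | true | false = refl
  ... | false | _ = refl

size-∪-≤ : ∀ {n} (A B : BSet n) → size (A ∪b B) ≤ size A + size B
size-∪-≤ A B = subst (size (A ∪b B) ≤_) (size-∪-∩ A B) (m≤m+n _ _)

size-⊆-split : ∀ {n} (A B : BSet n) → A ⊆b B → size B ≡ size A + size (B ∖b A)
size-⊆-split A B s = trans (size-split B A) (cong (_+ size (B ∖b A)) (size-cong _ _ h))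
  where
  h : ∀ i → B i ∧ A i ≡ A i
  h i with A i in ea
  ... | true rewrite s i ea = refl
  ... | false with B i
  ... | true = refl
  ... | false = refl

size-remove : ∀ {n} (A : BSet n) (x : Fin n) → A x ≡ true → size A ≡ suc (size (A -b x))
size-remove A x ax = trans (size-split A ⁅ x ⁆b) (cong (_+ size (A -b x)) (trans (size-cong _ _ h) (size-singleton x)))
  where
  h : ∀ i → A i ∧ eqF i x ≡ eqF i x
  h i with eqF i x in e
  ... | true rewrite subst (λ z → A z ≡ true) (sym (eqF⇒≡ {i = i} {x} e)) ax = refl
  h i | false with A i
  ... | true = refl
  ... | false = refl

size-full : ∀ {n} → size (fullb {n}) ≡ n
size-full {zero} = refl
size-full {suc n} = cong suc (size-full {n})

+-double-cancel-≤ : ∀ a b → a + a ≤ b + b → a ≤ b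
+-double-cancel-≤ a b h with a ≤? b
... | yes p = p
... | no np = ⊥-elim (<-irrefl refl (≤-trans (+-mono-< (≰⇒> np) (≰⇒> np)) h))

module _ {n : ℕ} where
  MapsTo : BSet n → (Fin n → Fin n) → BSet n → Set
  MapsTo A f B = ∀ i → A i ≡ true → B (f i) ≡ true

  InjectiveOn : BSet n → (Fin n → Fin n) → Set
  InjectiveOn A f = ∀ i j → A i ≡ true → A j ≡ true → f i ≡ f j → i ≡ j

  injection⇒size≤-by : ∀ k (A B : BSet n) f → size A ≡ k → MapsTo A f B → InjectiveOn A f → size A ≤ size B
  injection⇒size≤-by zero A B f e m ij rewrite e = z≤n
  injection⇒size≤-by (suc k) A B f e m ij =
    let (a , aa) = size>0⇒nonempty A (subst (0 <_) (sym e) (s≤s z≤n))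
        eA = size-remove A a aa
        eB = size-remove B (f a) (m a aa)
        m' : MapsTo (A -b a) f (B -b f a)
        m' i p = ∧-intro (m i (∧-elimˡ p)) (not-intro (≢⇒eqF-false (λ q → true-false-absurd (eqF-refl i)
                    (subst (λ z → eqF i z ≡ false) (sym (ij i a (∧-elimˡ p) aa q)) (not-elim (∧-elimʳ p))))))
        ij' : InjectiveOn (A -b a) f
        ij' i j p q r = ij i j (∧-elimˡ p) (∧-elimˡ q) r
        ih = injection⇒size≤-by k (A -b a) (B -b f a) f (suc-injective (trans (sym eA) e)) m' ij'
    in subst₂ _≤_ (sym eA) (sym eB) (s≤s ih)

  injection⇒size≤ : ∀ (A B : BSet n) f → MapsTo A f B → InjectiveOn A f → size A ≤ size B
  injection⇒size≤ A B f = injection⇒size≤-by (size A) A B f refl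

  hit? : (A : BSet n) (f : Fin n → Fin n) (b : Fin n) → Dec (∃ λ a → A a ≡ true × f a ≡ b)
  hit? A f b = FinP.any? (λ a → (A a BoolP.≟ true) ×-dec (f a FinP.≟ b))

  injection-onto : ∀ (A B : BSet n) f → MapsTo A f B → InjectiveOn A f → size B ≤ size A →
         ∀ b → B b ≡ true → ∃ λ a → A a ≡ true × f a ≡ b
  injection-onto A B f m ij le b bb with hit? A f b
  ... | yes r = r
  ... | no nr = ⊥-elim (<-irrefl refl (≤-trans (subst (_≤ size A) (size-remove B b bb) le)
                   (injection⇒size≤ A (B -b b) f m' ij)))
    where
    m' : MapsTo A f (B -b b)
    m' i p = ∧-intro (m i p) (not-intro (≢⇒eqF-false (λ q → nr (i , p , q))))

  preimage : (A : BSet n) (f : Fin n → Fin n) (b : Fin n) → Dec (∃ λ a → A a ≡ true × f a ≡ b) → Fin n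
  preimage A f b (yes (a , _)) = a
  preimage A f b (no _) = b

  preimage-spec : (A : BSet n) (f : Fin n → Fin n) (b : Fin n) (d : Dec (∃ λ a → A a ≡ true × f a ≡ b)) →
             (∃ λ a → A a ≡ true × f a ≡ b) → A (preimage A f b d) ≡ true × f (preimage A f b d) ≡ b
  preimage-spec A f b (yes (a , p)) _ = p
  preimage-spec A f b (no np) e = ⊥-elim (np e)

  onto⇒size≤ : ∀ (A B : BSet n) f → (∀ b → B b ≡ true → ∃ λ a → A a ≡ true × f a ≡ b) → size B ≤ size A
  onto⇒size≤ A B f h = injection⇒size≤ B A g m ij
    where
    g : Fin n → Fin n
    g b = preimage A f b (hit? A f b)
    m : MapsTo B g A
    m b p = proj₁ (preimage-spec A f b (hit? A f b) (h b p))
    ij : InjectiveOn B g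
    ij i j p q r = trans (sym (proj₂ (preimage-spec A f i (hit? A f i) (h i p))))
                    (trans (cong f r) (proj₂ (preimage-spec A f j (hit? A f j) (h j q))))

  ⊆∧size≥⇒⊇ : ∀ (A B : BSet n) → A ⊆b B → size B ≤ size A → B ⊆b A
  ⊆∧size≥⇒⊇ A B s le b bb = let (a , aa , e) = injection-onto A B id s (λ i j _ _ r → r) le b bb in subst (λ z → A z ≡ true) e aa

  size<⇒extra : ∀ (A B : BSet n) → A ⊆b B → size A < size B → ∃ λ b → B b ≡ true × A b ≡ false
  size<⇒extra A B s lt with FinP.any? (λ b → (B b BoolP.≟ true) ×-dec (A b BoolP.≟ false))
  ... | yes r = r
  ... | no nr = ⊥-elim (<-irrefl refl (≤-trans lt (size-mono B A h)))
    where
    h : B ⊆b A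
    h i p with A i in e
    ... | true = refl
    ... | false = ⊥-elim (nr (i , p , e))

  size≡1⇒unique : ∀ (A : BSet n) x y → size A ≡ 1 → A x ≡ true → A y ≡ true → y ≡ x
  size≡1⇒unique A x y c ax ay with eqF y x in e
  ... | true = eqF⇒≡ e
  ... | false = ⊥-elim (true-false-absurd (∧-intro ay (not-intro e)) (size≡0⇒empty (A -b x) (suc-injective (trans (sym (size-remove A x ax)) c)) y))

consB : ∀ {n} → Bool → BSet n → BSet (suc n)
consB b A zero = b
consB b A (suc i) = A i

allSubsets : (n : ℕ) → List (BSet n)
allSubsets zero = ∅b ∷ []
allSubsets (suc n) = map (consB false) (allSubsets n) ++ map (consB true) (allSubsets n)

allSubsets-complete : ∀ {n} (A : BSet n) → ∃ λ B → B ∈ allSubsets n × B ≐ A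
allSubsets-complete {zero} A = ∅b , here refl , λ ()
allSubsets-complete {suc n} A with allSubsets-complete (λ i → A (suc i))
... | (B , mem , eq) with A zero in e
... | false = consB false B , ∈-++⁺ˡ (∈-map⁺ (consB false) mem) , h
  where
  h : consB false B ≐ A
  h zero = sym e
  h (suc i) = eq i
... | true = consB true B , ∈-++⁺ʳ (map (consB false) (allSubsets n)) (∈-map⁺ (consB true) mem) , h
  where
  h : consB true B ≐ A
  h zero = sym e
  h (suc i) = eq i

module _ {n : ℕ} where
  Respects≐ : (BSet n → Set) → Set
  Respects≐ P = ∀ A B → A ≐ B → P A → P B

  Invariant≐ : (BSet n → ℕ) → Set
  Invariant≐ h = ∀ A B → A ≐ B → h A ≡ h B

  ∃-subset? : (P : BSet n → Set) → (∀ A → Dec (P A)) → Respects≐ P → Dec (∃ P)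
  ∃-subset? P P? ext with AnyM.any? P? (allSubsets n)
  ... | yes a = yes (AnyM.satisfied a)
  ... | no na = no λ (A , pa) → let (B , mem , eq) = allSubsets-complete A in
                   na (lose mem (ext A B (λ i → sym (eq i)) pa))

  argmax-list : (P : BSet n → Set) → (∀ A → Dec (P A)) → (h : BSet n → ℕ) → (l : List (BSet n)) →
            (∀ y → y ∈ l → ¬ P y) ⊎ (Σ (BSet n) λ x → P x × (∀ y → y ∈ l → P y → h y ≤ h x))
  argmax-list P P? h [] = inj₁ (λ y ())
  argmax-list P P? h (z ∷ l) with argmax-list P P? h l | P? z
  ... | inj₁ none | no nz = inj₁ λ { y (here refl) → nz ; y (there m) → none y m }
  ... | inj₁ none | yes pz = inj₂ (z , pz , λ { y (here refl) _ → ≤-refl ; y (there m) py → ⊥-elim (none y m py) })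
  ... | inj₂ (x , px , mx) | no nz = inj₂ (x , px , λ { y (here refl) py → ⊥-elim (nz py) ; y (there m) py → mx y m py })
  ... | inj₂ (x , px , mx) | yes pz with h z ≤? h x
  ... | yes le = inj₂ (x , px , λ { y (here refl) _ → le ; y (there m) py → mx y m py })
  ... | no gt = inj₂ (z , pz , λ { y (here refl) _ → ≤-refl ; y (there m) py → ≤-trans (mx y m py) (<⇒≤ (≰⇒> gt)) })

  argmax : (P : BSet n → Set) → (∀ A → Dec (P A)) → Respects≐ P → (h : BSet n → ℕ) → Invariant≐ h → ∃ P →
           Σ (BSet n) λ x → P x × (∀ A → P A → h A ≤ h x)
  argmax P P? ext h exth (A0 , p0) with argmax-list P P? h (allSubsets n)
  ... | inj₁ none = let (B , mem , eq) = allSubsets-complete A0 in ⊥-elim (none B mem (ext A0 B (λ i → sym (eq i)) p0))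
  ... | inj₂ (x , px , mx) = x , px , λ A pa → let (B , mem , eq) = allSubsets-complete A in
          subst (_≤ h x) (exth B A eq) (mx B mem (ext A B (λ i → sym (eq i)) pa))

unique-list-size≤ : ∀ {n} (L : List (Fin n)) (B : BSet n) → Unique L → All (λ x → B x ≡ true) L → length L ≤ size B
unique-list-size≤ [] B u a = z≤n
unique-list-size≤ (x ∷ L) B (ux ∷ u) (bx ∷ a) = subst (suc (length L) ≤_) (sym (size-remove B x bx))
  (s≤s (unique-list-size≤ L (B -b x) u (AllM.tabulate (λ {y} m → ∧-intro (AllM.lookup a m) (not-intro (≢⇒eqF-false (λ e → AllM.lookup ux m (sym e))))))))

∉-all : ∀ {n} {x : Fin n} {L : List (Fin n)} → All (λ y → ¬ x ≡ y) L → x ∈ L → ⊥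
∉-all a m = AllM.lookup a m refl

module _ {n : ℕ} where
  open import Data.List.Membership.DecPropositional (FinP._≟_ {n}) using (_∈?_)

  unique-list-covers : ∀ (L : List (Fin n)) (B : BSet n) → Unique L → All (λ x → B x ≡ true) L → size B ≤ length L →
                       ∀ b → B b ≡ true → b ∈ L
  unique-list-covers L B u a le b bb with b ∈? L
  ... | yes m = m
  ... | no nm = ⊥-elim (<-irrefl refl (≤-trans (subst (_≤ length L) (size-remove B b bb) le)
                   (unique-list-size≤ L (B -b b) u (AllM.tabulate (λ {y} m → ∧-intro (AllM.lookup a m) (not-intro (≢⇒eqF-false (λ e → nm (subst (_∈ L) e m)))))))))

fromList : ∀ {n} → List (Fin n) → BSet n
fromList [] v = false
fromList (x ∷ L) v = eqF v x ∨ fromList L v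

fromList⁻ : ∀ {n} (L : List (Fin n)) v → fromList L v ≡ true → v ∈ L
fromList⁻ (x ∷ L) v p with ∨-elim {eqF v x} p
... | inj₁ q = here (eqF⇒≡ q)
... | inj₂ q = there (fromList⁻ L v q)

fromList⁺ : ∀ {n} (L : List (Fin n)) v → v ∈ L → fromList L v ≡ true
fromList⁺ (x ∷ L) v (here refl) = ∨-introˡ (eqF-refl v)
fromList⁺ (x ∷ L) v (there m) = ∨-introʳ {eqF v x} (fromList⁺ L v m)

size-fromList≤ : ∀ {n} (L : List (Fin n)) → size (fromList L) ≤ length L
size-fromList≤ {n} [] = subst (_≤ 0) (sym (size-empty {n} (fromList []) (λ i → refl))) z≤n
size-fromList≤ (x ∷ L) = ≤-trans (size-∪-≤ ⁅ x ⁆b (fromList L))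
  (subst (_≤ suc (length L)) (sym (cong (_+ size (fromList L)) (size-singleton x))) (s≤s (size-fromList≤ L)))

module _ {n : ℕ} where
  elements : BSet n → List (Fin n)
  elements A = filter (λ i → A i BoolP.≟ true) (allFin n)

  elements⁺ : ∀ (A : BSet n) v → A v ≡ true → v ∈ elements A
  elements⁺ A v p = ∈-filter⁺ (λ i → A i BoolP.≟ true) {xs = allFin n} (∈-allFin v) p

  elements⁻ : ∀ (A : BSet n) v → v ∈ elements A → A v ≡ true
  elements⁻ A v m = proj₂ (∈-filter⁻ (λ i → A i BoolP.≟ true) {xs = allFin n} m)

  elements-unique : ∀ (A : BSet n) → Unique (elements A)
  elements-unique A = Unique.filter⁺ (λ i → A i BoolP.≟ true) (Unique.allFin⁺ n)

  length-elements : ∀ (A : BSet n) → length (elements A) ≡ size A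
  length-elements A = ≤-antisym
    (unique-list-size≤ (elements A) A (elements-unique A) (AllM.tabulate (λ {v} → elements⁻ A v)))
    (≤-trans (size-mono A (fromList (elements A)) (λ v p → fromList⁺ (elements A) v (elements⁺ A v p)))
             (size-fromList≤ (elements A)))

toBSet : ∀ {n} → Subset n → BSet n
toBSet p i = lookup p i

toSubset : ∀ {n} → BSet n → Subset n
toSubset A = tabulate A

toBSet-toSubset : ∀ {n} (A : BSet n) → toBSet (toSubset A) ≐ A
toBSet-toSubset A i = VecP.lookup∘tabulate A i

∈⇒toBSet : ∀ {n} {x : Fin n} {p : Subset n} → x ∈s p → toBSet p x ≡ true
∈⇒toBSet m = VecP.[]=⇒lookup m

toBSet⇒∈ : ∀ {n} {x : Fin n} {p : Subset n} → toBSet p x ≡ true → x ∈s p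
toBSet⇒∈ {x = x} {p} e = VecP.lookup⇒[]= x p e

∣∣≡size : ∀ {n} (p : Subset n) → ∣ p ∣ ≡ size (toBSet p)
∣∣≡size [] = refl
∣∣≡size (true ∷ p) = cong suc (∣∣≡size p)
∣∣≡size (false ∷ p) = ∣∣≡size p

lookup-⊥ : ∀ {n} (i : Fin n) → lookup (⊥s {n}) i ≡ false
lookup-⊥ zero = refl
lookup-⊥ (suc i) = lookup-⊥ i

lookup-⁅⁆ : ∀ {n} (x i : Fin n) → lookup ⁅ x ⁆ i ≡ eqF i x
lookup-⁅⁆ zero zero = refl
lookup-⁅⁆ zero (suc i) = lookup-⊥ i
lookup-⁅⁆ (suc x) zero = refl
lookup-⁅⁆ (suc x) (suc i) = lookup-⁅⁆ x i

lookup-minus : ∀ {n} (p : Subset n) (x i : Fin n) → lookup (p -s x) i ≡ (toBSet p -b x) i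
lookup-minus (b ∷ p) zero zero with b
... | true = refl
... | false = refl
lookup-minus (b ∷ p) zero (suc i) = trans (lem p i) (sym (BoolP.∧-identityʳ (lookup p i)))
  where
  lem : ∀ {m} (q : Subset m) (j : Fin m) → lookup (q ─ ⊥s) j ≡ lookup q j
  lem (c ∷ q) zero = refl
  lem (c ∷ q) (suc j) = lem q j
lookup-minus (b ∷ p) (suc x) zero = sym (BoolP.∧-identityʳ b)
lookup-minus (b ∷ p) (suc x) (suc i) = lookup-minus p x i

lookup-∪⁅⁆ : ∀ {n} (p : Subset n) (x i : Fin n) → lookup (p ∪s ⁅ x ⁆) i ≡ (toBSet p ∪b ⁅ x ⁆b) i
lookup-∪⁅⁆ p x i = trans (VecP.lookup-zipWith _∨_ i p ⁅ x ⁆) (cong (lookup p i ∨_) (lookup-⁅⁆ x i))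

anyB : ∀ {n} → BSet n → Bool
anyB {zero} A = false
anyB {suc n} A = A zero ∨ anyB (λ i → A (suc i))

anyB-intro : ∀ {n} (A : BSet n) i → A i ≡ true → anyB A ≡ true
anyB-intro A zero p = ∨-introˡ p
anyB-intro A (suc i) p = ∨-introʳ {A zero} (anyB-intro (λ j → A (suc j)) i p)

anyB-elim : ∀ {n} (A : BSet n) → anyB A ≡ true → ∃ λ i → A i ≡ true
anyB-elim {suc n} A p with ∨-elim {A zero} p
... | inj₁ q = zero , q
... | inj₂ q = let (i , r) = anyB-elim (λ j → A (suc j)) q in suc i , r

anyB-ext : ∀ {n} (A B : BSet n) → A ≐ B → anyB A ≡ anyB B
anyB-ext {zero} A B e = refl
anyB-ext {suc n} A B e = cong₂ _∨_ (e zero) (anyB-ext _ _ (λ i → e (suc i)))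

anyB-false : ∀ {n} (A : BSet n) → (∀ i → A i ≡ true → ⊥) → anyB A ≡ false
anyB-false A h with anyB A in e
... | true = ⊥-elim (let (i , p) = anyB-elim A e in h i p)
... | false = refl

module Neighbourhood {n : ℕ} (a : Fin n → Fin n → Bool) where

  nbhd : BSet n → BSet n
  nbhd T v = anyB (λ u → T u ∧ a u v)

  nbhd-intro : ∀ T u v → T u ≡ true → a u v ≡ true → nbhd T v ≡ true
  nbhd-intro T u v p q = anyB-intro (λ u → T u ∧ a u v) u (∧-intro p q)

  nbhd-elim : ∀ T v → nbhd T v ≡ true → ∃ λ u → T u ≡ true × a u v ≡ true
  nbhd-elim T v p = let (u , q) = anyB-elim (λ u → T u ∧ a u v) p in u , ∧-elimˡ q , ∧-elimʳ {T u} q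

  nbhd-mono : ∀ T T' → T ⊆b T' → nbhd T ⊆b nbhd T'
  nbhd-mono T T' s v p = let (u , tu , auv) = nbhd-elim T v p in nbhd-intro T' u v (s u tu) auv

  nbhd-cong : ∀ T T' → T ≐ T' → nbhd T ≐ nbhd T'
  nbhd-cong T T' e v = anyB-ext _ _ (λ u → cong (_∧ a u v) (e u))

  nbhd-false : ∀ T v → (∀ u → T u ≡ true → a u v ≡ true → ⊥) → nbhd T v ≡ false
  nbhd-false T v h = anyB-false _ (λ u q → h u (∧-elimˡ q) (∧-elimʳ {T u} q))

  HallCondition : BSet n → BSet n → Set
  HallCondition X Y = ∀ T → T ⊆b X → size T ≤ size (nbhd T ∩b Y)

  MatchingInto : BSet n → BSet n → (Fin n → Fin n) → Set
  MatchingInto X Y f = MapsTo X f Y × (∀ x → X x ≡ true → a x (f x) ≡ true) × InjectiveOn X f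

  Tight : BSet n → BSet n → BSet n → Set
  Tight X Y T = T ⊆b X × 0 < size T × size T < size X × size (nbhd T ∩b Y) ≤ size T

  tight? : ∀ X Y T → Dec (Tight X Y T)
  tight? X Y T = _⊆b?_ T X ×-dec ((0 <? size T) ×-dec ((size T <? size X) ×-dec (size (nbhd T ∩b Y) ≤? size T)))

  Tight-respects : ∀ X Y → Respects≐ (Tight X Y)
  Tight-respects X Y T T' e (s , p , q , r) =
    (λ i t → s i (trans (e i) t)) ,
    subst (0 <_) c p , subst (_< size X) c q ,
    subst₂ _≤_ (size-cong _ _ (λ v → cong (_∧ Y v) (nbhd-cong T T' e v))) c r
    where c = size-cong T T' e

  MatchingInto-empty : ∀ X Y f → (∀ i → X i ≡ false) → MatchingInto X Y f
  MatchingInto-empty X Y f empty =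
    (λ i p → ⊥-elim (true-false-absurd p (empty i))) ,
    (λ i p → ⊥-elim (true-false-absurd p (empty i))) ,
    (λ i j p → ⊥-elim (true-false-absurd p (empty i)))

  HallRec : ℕ → Set
  HallRec k = ∀ X Y → size X ≤ k → HallCondition X Y → Σ (Fin n → Fin n) (MatchingInto X Y)

  HallCondition-restrict : ∀ X Y T → HallCondition X Y → T ⊆b X → HallCondition T (nbhd T ∩b Y)
  HallCondition-restrict X Y T hc sTX T' s = ≤-trans (hc T' (λ i p → sTX i (s i p)))
               (size-mono (nbhd T' ∩b Y) (nbhd T' ∩b (nbhd T ∩b Y)) (λ v p → ∧-intro (∧-elimˡ {nbhd T' v} p) (∧-intro (nbhd-mono T' T s v (∧-elimˡ {nbhd T' v} p)) (∧-elimʳ {nbhd T' v} p))))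

  HallCondition-complement : ∀ X Y T → HallCondition X Y → T ⊆b X → size (nbhd T ∩b Y) ≤ size T →
                             HallCondition (X ∖b T) (Y ∖b nbhd T)
  HallCondition-complement X Y T hc sTX tT R sR = +-cancelʳ-≤ (size T) _ _ (begin
    size R + size T                                       ≡⟨ sym eR ⟩
    size (R ∪b T)                                         ≤⟨ hc (R ∪b T) sRT ⟩
    size (nbhd (R ∪b T) ∩b Y)                             ≤⟨ size-mono _ _ inc ⟩
    size ((nbhd R ∩b (Y ∖b nbhd T)) ∪b (nbhd T ∩b Y))     ≤⟨ size-∪-≤ (nbhd R ∩b (Y ∖b nbhd T)) (nbhd T ∩b Y) ⟩
    size (nbhd R ∩b (Y ∖b nbhd T)) + size (nbhd T ∩b Y)   ≤⟨ +-monoʳ-≤ (size (nbhd R ∩b (Y ∖b nbhd T))) tT ⟩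
    size (nbhd R ∩b (Y ∖b nbhd T)) + size T               ∎)
    where
    open ≤-Reasoning
    eR : size (R ∪b T) ≡ size R + size T
    eR = size-disjoint-∪ R T (λ i p q → true-false-absurd q (not-elim (∧-elimʳ {X i} (sR i p))))
    sRT : (R ∪b T) ⊆b X
    sRT i p with ∨-elim {R i} p
    ... | inj₁ q = ∧-elimˡ (sR i q)
    ... | inj₂ q = sTX i q
    from-R : ∀ v u → nbhd T v ≡ false → (R ∪b T) u ≡ true → a u v ≡ true → nbhd R v ≡ true
    from-R v u e uRT auv with ∨-elim {R u} uRT
    ... | inj₁ q = nbhd-intro R u v q auv
    ... | inj₂ q = ⊥-elim (true-false-absurd (nbhd-intro T u v q auv) e)
    inc : (nbhd (R ∪b T) ∩b Y) ⊆b ((nbhd R ∩b (Y ∖b nbhd T)) ∪b (nbhd T ∩b Y))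
    inc v p with nbhd T v in e
    ... | true = ∨-introʳ {nbhd R v ∧ (Y v ∧ false)} (∧-intro refl (∧-elimʳ {nbhd (R ∪b T) v} p))
    ... | false = ∨-introˡ (∧-intro (let (u , uRT , auv) = nbhd-elim (R ∪b T) v (∧-elimˡ p) in from-R v u e uRT auv)
                                   (∧-intro (∧-elimʳ {nbhd (R ∪b T) v} p) refl))

  -- A tight T splits the problem: match T into N(T) ∩ Y and X ∖ T into Y ∖ N(T).
  hall-split : ∀ k → HallRec k → ∀ X Y → size X ≤ suc k → HallCondition X Y →
               ∀ T → Tight X Y T → Σ (Fin n → Fin n) (MatchingInto X Y)
  hall-split k rec X Y le hc T (sTX , pT , ltT , tT) = f , mt , ad , ij
    where
    Y1 = nbhd T ∩b Y
    X2 = X ∖b T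
    Y2 = Y ∖b nbhd T
    hc1 = HallCondition-restrict X Y T hc sTX
    hc2 = HallCondition-complement X Y T hc sTX tT
    eX : size X ≡ size T + size X2
    eX = size-⊆-split T X sTX
    r1 = rec T Y1 (≤-pred (≤-trans ltT le)) hc1
    r2 = rec X2 Y2 (≤-pred (≤-trans (subst (size X2 <_) (sym eX) (+-monoˡ-< (size X2) pT)) le)) hc2
    f1 = proj₁ r1
    f2 = proj₁ r2
    f : Fin n → Fin n
    f = piecewise T f1 f2
    mt : MapsTo X f Y
    mt i p with T i in e
    ... | true = ∧-elimʳ {nbhd T (f1 i)} (proj₁ (proj₂ r1) i e)
    ... | false = ∧-elimˡ (proj₁ (proj₂ r2) i (∧-intro p (not-intro e)))
    ad : ∀ x → X x ≡ true → a x (f x) ≡ true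
    ad i p with T i in e
    ... | true = proj₁ (proj₂ (proj₂ r1)) i e
    ... | false = proj₁ (proj₂ (proj₂ r2)) i (∧-intro p (not-intro e))
    ij : InjectiveOn X f
    ij i j p q r with T i in ei | T j in ej
    ... | true | true = proj₂ (proj₂ (proj₂ r1)) i j ei ej r
    ... | false | false = proj₂ (proj₂ (proj₂ r2)) i j (∧-intro p (not-intro ei)) (∧-intro q (not-intro ej)) r
    ... | true | false = ⊥-elim (true-false-absurd (∧-elimˡ (proj₁ (proj₂ r1) i ei))
                           (subst (λ z → nbhd T z ≡ false) (sym r) (not-elim (∧-elimʳ {Y (f2 j)} (proj₁ (proj₂ r2) j (∧-intro q (not-intro ej)))))))
    ... | false | true = ⊥-elim (true-false-absurd (∧-elimˡ (proj₁ (proj₂ r1) j ej))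
                           (subst (λ z → nbhd T z ≡ false) r (not-elim (∧-elimʳ {Y (f2 i)} (proj₁ (proj₂ r2) i (∧-intro p (not-intro ei)))))))

  HallCondition-remove : ∀ X Y x y → (∀ T → ¬ Tight X Y T) → X x ≡ true → HallCondition (X -b x) (Y -b y)
  HallCondition-remove X Y x y none Xx T sT with size T in cT
  ... | zero = z≤n
  ... | suc t = ≤-pred (begin-strict
    suc t                                       ≡⟨ sym cT ⟩
    size T                                      <⟨ surplus ⟩
    size (nbhd T ∩b Y)                          ≤⟨ size-mono _ _ inc ⟩
    size ((nbhd T ∩b (Y -b y)) ∪b ⁅ y ⁆b)       ≤⟨ size-∪-≤ (nbhd T ∩b (Y -b y)) ⁅ y ⁆b ⟩
    size (nbhd T ∩b (Y -b y)) + size ⁅ y ⁆b     ≡⟨ cong (size (nbhd T ∩b (Y -b y)) +_) (size-singleton y) ⟩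
    size (nbhd T ∩b (Y -b y)) + 1               ≡⟨ +-comm _ 1 ⟩
    suc (size (nbhd T ∩b (Y -b y)))             ∎)
    where
    open ≤-Reasoning
    sTX : T ⊆b X
    sTX i p = ∧-elimˡ (sT i p)
    ltX : size T < size X
    ltX = subst (size T <_) (sym (size-remove X x Xx)) (s≤s (size-mono T (X -b x) sT))
    surplus : size T < size (nbhd T ∩b Y)
    surplus = ≰⇒> (λ le' → none T (sTX , subst (0 <_) (sym cT) (s≤s z≤n) , ltX , le'))
    inc : (nbhd T ∩b Y) ⊆b ((nbhd T ∩b (Y -b y)) ∪b ⁅ y ⁆b)
    inc v p with eqF v y in e
    ... | true = ∨-introʳ {nbhd T v ∧ (Y v ∧ false)} refl
    ... | false = ∨-introˡ (∧-intro (∧-elimˡ {nbhd T v} p) (∧-intro (∧-elimʳ {nbhd T v} p) refl))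

  -- Without a tight set every proper subset has surplus, so any edge x y can be
  -- put into the matching and Hall's condition survives in X - x, Y - y.
  hall-peel : ∀ k → HallRec k → ∀ X Y → size X ≤ suc k → 0 < size X → HallCondition X Y →
              (∀ T → ¬ Tight X Y T) → Σ (Fin n → Fin n) (MatchingInto X Y)
  hall-peel k rec X Y le pos hc none = f , mt , ad , ij
    where
    xx = size>0⇒nonempty X pos
    x = proj₁ xx
    Xx = proj₂ xx
    hx : 1 ≤ size (nbhd ⁅ x ⁆b ∩b Y)
    hx = subst (_≤ size (nbhd ⁅ x ⁆b ∩b Y)) (size-singleton x)
           (hc ⁅ x ⁆b (λ i p → subst (λ z → X z ≡ true) (sym (eqF⇒≡ p)) Xx))
    yy = size>0⇒nonempty (nbhd ⁅ x ⁆b ∩b Y) hx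
    y = proj₁ yy
    axy : a x y ≡ true
    axy = let (u , ux , auy) = nbhd-elim ⁅ x ⁆b y (∧-elimˡ (proj₂ yy)) in subst (λ z → a z y ≡ true) (eqF⇒≡ ux) auy
    Yy : Y y ≡ true
    Yy = ∧-elimʳ {nbhd ⁅ x ⁆b y} (proj₂ yy)
    X' = X -b x
    Y' = Y -b y
    eX : size X ≡ suc (size X')
    eX = size-remove X x Xx
    hc' = HallCondition-remove X Y x y none Xx
    r' = rec X' Y' (≤-pred (subst (_≤ suc k) eX le)) hc'
    f' = proj₁ r'
    f : Fin n → Fin n
    f v = if eqF v x then y else f' v
    mt : MapsTo X f Y
    mt i p with eqF i x in e
    ... | true = Yy
    ... | false = ∧-elimˡ (proj₁ (proj₂ r') i (∧-intro p (not-intro e)))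
    ad : ∀ v → X v ≡ true → a v (f v) ≡ true
    ad i p with eqF i x in e
    ... | true = subst (λ z → a z y ≡ true) (sym (eqF⇒≡ e)) axy
    ... | false = proj₁ (proj₂ (proj₂ r')) i (∧-intro p (not-intro e))
    ij : InjectiveOn X f
    ij i j p q r with eqF i x in ei | eqF j x in ej
    ... | true | true = trans (eqF⇒≡ ei) (sym (eqF⇒≡ ej))
    ... | false | false = proj₂ (proj₂ (proj₂ r')) i j (∧-intro p (not-intro ei)) (∧-intro q (not-intro ej)) r
    ... | true | false = ⊥-elim (true-false-absurd (subst (λ z → eqF z y ≡ true) r (eqF-refl y))
                           (not-elim (∧-elimʳ {Y (f' j)} (proj₁ (proj₂ r') j (∧-intro q (not-intro ej))))))
    ... | false | true = ⊥-elim (true-false-absurd (subst (λ z → eqF z y ≡ true) (sym r) (eqF-refl y))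
                           (not-elim (∧-elimʳ {Y (f' i)} (proj₁ (proj₂ r') i (∧-intro p (not-intro ei))))))

  hall-by : ∀ k → HallRec k
  hall-by k X Y le hc with size X in cX
  ... | zero = id , MatchingInto-empty X Y id (size≡0⇒empty X cX)
  hall-by zero X Y () hc | suc m
  hall-by (suc k) X Y le hc | suc m with ∃-subset? (Tight X Y) (tight? X Y) (Tight-respects X Y)
  ... | yes (T , tight) = hall-split k (hall-by k) X Y (subst (_≤ suc k) (sym cX) le) hc T tight
  ... | no none = hall-peel k (hall-by k) X Y (subst (_≤ suc k) (sym cX) le) (subst (0 <_) (sym cX) (s≤s z≤n)) hc
                            (λ T t → none (T , t))

  hall : ∀ X Y → HallCondition X Y → Σ (Fin n → Fin n) (MatchingInto X Y)
  hall X Y = hall-by (size X) X Y ≤-refl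

  -- A subset of X of maximal deficiency |T| - |N(T) ∩ Y|; the argmax is taken of
  -- |T| + (n ∸ |N(T) ∩ Y|), which is the same up to the constant n but stays in ℕ.
  max-deficiency : ∀ X Y → Σ (BSet n) λ T → T ⊆b X ×
                   (∀ T' → T' ⊆b X → size T' + size (nbhd T ∩b Y) ≤ size T + size (nbhd T' ∩b Y))
  max-deficiency X Y = T , sTX , λ T' s → from-objective (size T') (size (nbhd T' ∩b Y)) (size T) (size (nbhd T ∩b Y))
                                              (max T' s) (size≤n _) (size≤n _)
    where
    objective : BSet n → ℕ
    objective T = size T + (n ∸ size (nbhd T ∩b Y))
    objective-cong : Invariant≐ objective
    objective-cong T T' e = cong₂ _+_ (size-cong T T' e) (cong (n ∸_) (size-cong _ _ (λ v → cong (_∧ Y v) (nbhd-cong T T' e v))))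
    best = argmax (_⊆b X) (_⊆b? X) (λ T T' e s i p → s i (trans (e i) p)) objective objective-cong (∅b , λ i ())
    T = proj₁ best
    sTX = proj₁ (proj₂ best)
    max = proj₂ (proj₂ best)
    from-objective : ∀ a b c d → a + (n ∸ b) ≤ c + (n ∸ d) → b ≤ n → d ≤ n → a + d ≤ c + b
    from-objective a b c d h bn dn = +-cancelʳ-≤ n (a + d) (c + b)
      (subst₂ _≤_ (trans (shuffle a (n ∸ b) b d) (cong ((a + d) +_) (m∸n+n≡m bn)))
                  (trans (trans (cong ((c + (n ∸ d)) +_) (+-comm b d)) (shuffle c (n ∸ d) d b)) (cong ((c + b) +_) (m∸n+n≡m dn)))
         (+-monoˡ-≤ (b + d) h))
      where
      shuffle : ∀ a x b d → (a + x) + (b + d) ≡ (a + d) + (x + b)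
      shuffle = solve-∀

-- Recurse into a tight subset if there is one; otherwise pick a
-- second neighbour t1 of some p1 and delete the edge from p0 = f⁻¹ t1 to t1: proper
-- subsets keep their surplus and P still reaches t1 through p1, so Hall's theorem
-- yields a matching f' with f' p0 ≠ f p0.
module AlternativeMatching {n : ℕ} (a : Fin n → Fin n → Bool) where

  open Neighbourhood a

  AnotherMatching : BSet n → BSet n → (Fin n → Fin n) → Set
  AnotherMatching P T f = Σ (Fin n → Fin n) λ f' → MatchingInto P T f' × ∃ λ p0 → P p0 ≡ true × ¬ f' p0 ≡ f p0

  another-matching-tight : ∀ P T f B → MatchingInto P T f → B ⊆b P → size (nbhd B ∩b T) ≤ size B →
          AnotherMatching B (nbhd B ∩b T) f → AnotherMatching P T f
  another-matching-tight P T f B (mt , ad , ij) sBP tB (fB , (mtB , adB , ijB) , (p0 , bp0 , ne0)) = F , (mtF , adF , ijF) , (p0 , sBP p0 bp0 , ne)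
    where
    TB = nbhd B ∩b T
    F : Fin n → Fin n
    F = piecewise B fB f
    F-t : ∀ v → B v ≡ true → F v ≡ fB v
    F-t v p = piecewise-true B fB f v p
    F-f : ∀ v → B v ≡ false → F v ≡ f v
    F-f v p = piecewise-false B fB f v p
    mapB : MapsTo B f TB
    mapB b p = ∧-intro (nbhd-intro B b (f b) p (ad b (sBP b p))) (mt b (sBP b p))
    mtF : MapsTo P F T
    mtF v p with true-or-false (B v)
    ... | inj₁ q = subst (λ z → T z ≡ true) (sym (F-t v q)) (∧-elimʳ {nbhd B (fB v)} (mtB v q))
    ... | inj₂ q = subst (λ z → T z ≡ true) (sym (F-f v q)) (mt v p)
    adF : ∀ v → P v ≡ true → a v (F v) ≡ true
    adF v p with true-or-false (B v)
    ... | inj₁ q = subst (λ z → a v z ≡ true) (sym (F-t v q)) (adB v q)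
    ... | inj₂ q = subst (λ z → a v z ≡ true) (sym (F-f v q)) (ad v p)
    mixed : ∀ b p → B b ≡ true → P p ≡ true → B p ≡ false → fB b ≡ f p → ⊥
    mixed b p bb pp bp e = let (b' , bb' , e') = injection-onto B TB f mapB (λ i j x y → ij i j (sBP i x) (sBP j y)) tB (f p)
                                                       (subst (λ z → TB z ≡ true) e (mtB b bb)) in
                           true≢false (trans (sym bb') (trans (cong B (ij b' p (sBP b' bb') pp e')) bp))
    ijF : InjectiveOn P F
    ijF u v p q e with true-or-false (B u) | true-or-false (B v)
    ... | inj₁ a | inj₁ b = ijB u v a b (trans (sym (F-t u a)) (trans e (F-t v b)))
    ... | inj₂ a | inj₂ b = ij u v p q (trans (sym (F-f u a)) (trans e (F-f v b)))
    ... | inj₁ a | inj₂ b = ⊥-elim (mixed u v a q b (trans (sym (F-t u a)) (trans e (F-f v b))))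
    ... | inj₂ a | inj₁ b = ⊥-elim (mixed v u b p a (trans (sym (F-t v b)) (trans (sym e) (F-f u a))))
    ne : ¬ F p0 ≡ f p0
    ne e = ne0 (trans (sym (F-t p0 bp0)) e)

  module AnotherMatchingNoTight (P T : BSet n) (f : Fin n → Fin n) (mi : MatchingInto P T f) (leT : size T ≤ size P)
             (nt : ∀ B → Tight P T B → ⊥) (p1 t1 : Fin n) (pp1 : P p1 ≡ true) (tt1 : T t1 ≡ true)
             (a1 : a p1 t1 ≡ true) (ne1 : ¬ t1 ≡ f p1) where
    mt = proj₁ mi
    ad = proj₁ (proj₂ mi)
    ij = proj₂ (proj₂ mi)
    sj = injection-onto P T f mt ij leT t1 tt1
    p0 = proj₁ sj
    pp0 = proj₁ (proj₂ sj)
    e0 : f p0 ≡ t1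
    e0 = proj₂ (proj₂ sj)
    p0≢p1 : ¬ p0 ≡ p1
    p0≢p1 e = ne1 (trans (sym e0) (cong f e))
    a' : Fin n → Fin n → Bool
    a' u v = a u v ∧ not (eqF u p0 ∧ eqF v t1)
    module Pruned = Neighbourhood a'

    a'-p1 : ∀ v → a p1 v ≡ true → a' p1 v ≡ true
    a'-p1 v a rewrite ≢⇒eqF-false {i = p1} {p0} (λ e → p0≢p1 (sym e)) = ∧-intro a refl
    a'-ne : ∀ u v → a u v ≡ true → ¬ u ≡ p0 → a' u v ≡ true
    a'-ne u v a ne rewrite ≢⇒eqF-false ne = ∧-intro a refl
    a'-nt : ∀ u v → a u v ≡ true → ¬ v ≡ t1 → a' u v ≡ true
    a'-nt u v a ne rewrite ≢⇒eqF-false ne | BoolP.∧-zeroʳ (eqF u p0) = ∧-intro a refl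

    hc' : Pruned.HallCondition P T
    hc' B sB with size P ≤? size B
    ... | yes ge = ≤-trans (size-mono B P sB) (≤-trans (injection⇒size≤ P T f mt ij) (size-mono T (Pruned.nbhd B ∩b T) cov))
      where
      eqBP = ⊆∧size≥⇒⊇ B P sB ge
      cov : T ⊆b (Pruned.nbhd B ∩b T)
      cov t tt = let (p , pp , ep) = injection-onto P T f mt ij leT t tt in ∧-intro (pick p pp ep (true-or-false (eqF p p0))) tt
        where
        pick : ∀ p → P p ≡ true → f p ≡ t → eqF p p0 ≡ true ⊎ eqF p p0 ≡ false → Pruned.nbhd B t ≡ true
        pick p pp ep (inj₁ q) = Pruned.nbhd-intro B p1 t (eqBP p1 pp1)
          (a'-p1 t (subst (λ z → a p1 z ≡ true) (trans (sym e0) (trans (cong f (sym (eqF⇒≡ q))) ep)) a1))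
        pick p pp ep (inj₂ q) = Pruned.nbhd-intro B p t (eqBP p pp)
          (a'-ne p t (subst (λ z → a p z ≡ true) ep (ad p pp)) (λ e → true≢false (trans (sym (subst (λ z → eqF z p0 ≡ true) (sym e) (eqF-refl p0))) q)))
    ... | no lt = main (size B ≟ 0)
      where
      inc : (nbhd B ∩b T) ⊆b ((Pruned.nbhd B ∩b T) ∪b ⁅ t1 ⁆b)
      inc v p with true-or-false (eqF v t1)
      ... | inj₁ q = ∨-introʳ {Pruned.nbhd B v ∧ T v} q
      ... | inj₂ q = ∨-introˡ (∧-intro (let (b , bb , a) = nbhd-elim B v (∧-elimˡ {nbhd B v} p) in
                                 Pruned.nbhd-intro B b v bb (a'-nt b v a (λ e → true≢false (trans (sym (subst (λ z → eqF z t1 ≡ true) (sym e) (eqF-refl t1))) q))))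
                               (∧-elimʳ {nbhd B v} p))

      main : Dec (size B ≡ 0) → size B ≤ size (Pruned.nbhd B ∩b T)
      main (yes e) = subst (_≤ size (Pruned.nbhd B ∩b T)) (sym e) z≤n
      main (no nz) = ≤-pred (≤-trans notT
                   (subst (size (nbhd B ∩b T) ≤_) (+-comm (size (Pruned.nbhd B ∩b T)) 1)
                     (≤-trans (size-mono (nbhd B ∩b T) ((Pruned.nbhd B ∩b T) ∪b ⁅ t1 ⁆b) inc)
                       (≤-trans (size-∪-≤ (Pruned.nbhd B ∩b T) ⁅ t1 ⁆b) (≤-reflexive (cong (size (Pruned.nbhd B ∩b T) +_) (size-singleton t1)))))))
        where
        notT : size B < size (nbhd B ∩b T)
        notT = ≰⇒> (λ le' → nt B (sB , n≢0⇒n>0 nz , ≰⇒> lt , le'))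
    hres = Pruned.hall P T hc'
    f' = proj₁ hres
    result : AnotherMatching P T f
    result = f' , (proj₁ (proj₂ hres) , (λ x p → ∧-elimˡ {a x (f' x)} (proj₁ (proj₂ (proj₂ hres)) x p)) , proj₂ (proj₂ (proj₂ hres))) ,
             (p0 , pp0 , ne)
      where
      ne : ¬ f' p0 ≡ f p0
      ne e with proj₁ (proj₂ (proj₂ hres)) p0 pp0
      ... | q = true≢false (trans (sym (cong₂ _∧_ (eqF-refl p0) (trans (cong (λ z → eqF z t1) (trans e e0)) (eqF-refl t1)))) (not-elim (∧-elimʳ {a p0 (f' p0)} q)))

  another-matching : ∀ k P T f → size P ≤ k → MatchingInto P T f → size T ≤ size P →
           (∀ p → P p ≡ true → ∃ λ t → T t ≡ true × a p t ≡ true × ¬ t ≡ f p) → (∃ λ p → P p ≡ true) → AnotherMatching P T f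
  another-matching zero P T f le mi leT oth (p , pp) = ⊥-elim (true-false-absurd pp (size≡0⇒empty P (n≤0⇒n≡0 le) p))
  another-matching (suc k) P T f le mi leT oth ne with ∃-subset? (Tight P T) (tight? P T) (Tight-respects P T)
  ... | yes (B , sBP , pB , ltB , tB) =
        another-matching-tight P T f B mi sBP tB (another-matching k B (nbhd B ∩b T) f (≤-pred (≤-trans ltB le)) miB tB othB (size>0⇒nonempty B pB))
    where
    miB : MatchingInto B (nbhd B ∩b T) f
    miB = (λ b p → ∧-intro (nbhd-intro B b (f b) p (proj₁ (proj₂ mi) b (sBP b p))) (proj₁ mi b (sBP b p))) ,
          (λ b p → proj₁ (proj₂ mi) b (sBP b p)) ,
          (λ i j p q r → proj₂ (proj₂ mi) i j (sBP i p) (sBP j q) r)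
    othB : ∀ p → B p ≡ true → ∃ λ t → (nbhd B ∩b T) t ≡ true × a p t ≡ true × ¬ t ≡ f p
    othB p bp = let (t , tt , a , nq) = oth p (sBP p bp) in t , ∧-intro (nbhd-intro B p t bp a) tt , a , nq
  ... | no nt = let (p1 , pp1) = ne ; (t1 , tt1 , a1 , ne1) = oth p1 pp1 in
                AnotherMatchingNoTight.result P T f mi leT (λ B tb → nt (B , tb)) p1 t1 pp1 tt1 a1 ne1

module GraphBasics {n : ℕ} (G : Graph n) where

  open Neighbourhood (adj G) public

  V : List (Fin n × Fin n) → List (Fin n)
  V M = Endpoints G M

  StableB : BSet n → Set
  StableB A = ∀ u v → A u ≡ true → A v ≡ true → adj G u v ≡ false

  adj-sym′ : ∀ u v → adj G u v ≡ true → adj G v u ≡ true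
  adj-sym′ u v p = trans (adj-sym G v u) p

  InClosedNbhdᵇ : BSet n → Fin n → Set
  InClosedNbhdᵇ A v = A v ≡ true ⊎ ∃ λ u → A u ≡ true × adj G u v ≡ true

  Ψᵇ : BSet n → Set
  Ψᵇ A = StableB A × (∀ B → StableB B → (∀ v → B v ≡ true → InClosedNbhdᵇ A v) → size B ≤ size A)

  MinSurplus : BSet n → Set
  MinSurplus A = ∀ T → T ⊆b A → size T + size (nbhd A) ≤ size A + size (nbhd T)

  stable-⊆ : ∀ A B → A ⊆b B → StableB B → StableB A
  stable-⊆ A B s st u v p q = st u v (s u p) (s v q)

  stable-∪ : ∀ A B → StableB A → StableB B → (∀ u v → A u ≡ true → B v ≡ true → adj G u v ≡ true → ⊥) →
             StableB (A ∪b B)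
  stable-∪ A B sa sb cr u v p q with adj G u v in e
  ... | false = refl
  ... | true with ∨-elim {A u} p | ∨-elim {A v} q
  ... | inj₁ p' | inj₁ q' = ⊥-elim (true≢false (trans (sym e) (sa u v p' q')))
  ... | inj₂ p' | inj₂ q' = ⊥-elim (true≢false (trans (sym e) (sb u v p' q')))
  ... | inj₁ p' | inj₂ q' = ⊥-elim (cr u v p' q' e)
  ... | inj₂ p' | inj₁ q' = ⊥-elim (cr v u q' p' (adj-sym′ u v e))

  stable-nbhd-outside : ∀ S v → StableB S → nbhd S v ≡ true → S v ≡ false
  stable-nbhd-outside S v st p with S v in e
  ... | false = refl
  ... | true = let (u , su , a) = nbhd-elim S v p in ⊥-elim (true≢false (trans (sym a) (st u v su e)))

  Ψᵇ-cong : ∀ A A' → A ≐ A' → Ψᵇ A → Ψᵇ A'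
  Ψᵇ-cong A A' e (st , mx) = (λ u v p q → st u v (trans (e u) p) (trans (e v) q)) ,
     λ B sb inb → subst (size B ≤_) (size-cong A A' e) (mx B sb (λ v p → tr v (inb v p)))
    where
    tr : ∀ v → InClosedNbhdᵇ A' v → InClosedNbhdᵇ A v
    tr v (inj₁ p) = inj₁ (trans (e v) p)
    tr v (inj₂ (u , p , q)) = inj₂ (u , trans (e u) p , q)

  Ψᵇ-∅ : Ψᵇ ∅b
  Ψᵇ-∅ = (λ u v ()) , λ B sb inb → subst (_≤ size (∅b {n})) (sym (size-empty B (h B inb)))
           (subst (0 ≤_) (sym (size-∅ {n})) z≤n)
    where
    h : ∀ (B : BSet n) → (∀ v → B v ≡ true → InClosedNbhdᵇ ∅b v) → ∀ i → B i ≡ false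
    h B inb i with B i in e
    ... | false = refl
    ... | true with inb i e
    ... | inj₁ ()
    ... | inj₂ (u , () , _)

  MinSurplus⇒Ψ : ∀ S → StableB S → MinSurplus S → Ψᵇ S
  MinSurplus⇒Ψ S st surplus = st , mx
    where
    mx : ∀ B → StableB B → (∀ v → B v ≡ true → InClosedNbhdᵇ S v) → size B ≤ size S
    mx B sb inb = subst (_≤ size S) (sym (size-split B S))
        (combine (size (B ∩b S)) (size B2) (size T) (size (nbhd T)) (size (nbhd S)) (size S)
                 k2 k1 (surplus T (λ i p → ∧-elimˡ {S i} p)))
      where
      B2 = B ∖b S
      T = S ∖b nbhd B2
      combine : ∀ bs b2 t nt ns s → bs ≤ t → nt + b2 ≤ ns → t + ns ≤ s + nt → bs + b2 ≤ s
      combine bs b2 t nt ns s p q r = +-cancelʳ-≤ nt (bs + b2) s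
        (subst (_≤ s + nt) (sym (assoc bs b2 nt)) (≤-trans (+-mono-≤ p q) r))
        where
        assoc : ∀ bs b2 nt → (bs + b2) + nt ≡ bs + (nt + b2)
        assoc = solve-∀
      b2nb : B2 ⊆b nbhd S
      b2nb v p with inb v (∧-elimˡ {B v} p)
      ... | inj₁ q = ⊥-elim (true-false-absurd q (not-elim (∧-elimʳ {B v} p)))
      ... | inj₂ (u , su , a) = nbhd-intro S u v su a
      k1 : size (nbhd T) + size B2 ≤ size (nbhd S)
      k1 = subst (_≤ size (nbhd S)) (size-disjoint-∪ (nbhd T) B2 d) (size-mono _ _ sub)
        where
        d : ∀ i → nbhd T i ≡ true → B2 i ≡ true → ⊥
        d i p q = let (t , tt , a) = nbhd-elim T i p in
                  true-false-absurd (nbhd-intro B2 i t q (adj-sym′ t i a)) (not-elim (∧-elimʳ {S t} tt))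
        sub : (nbhd T ∪b B2) ⊆b nbhd S
        sub i p with ∨-elim {nbhd T i} p
        ... | inj₁ q = nbhd-mono T S (λ j r → ∧-elimˡ {S j} r) i q
        ... | inj₂ q = b2nb i q
      k2 : size (B ∩b S) ≤ size T
      k2 = size-mono _ _ sub
        where
        sub : (B ∩b S) ⊆b T
        sub i p with nbhd B2 i in e
        ... | false = ∧-intro (∧-elimʳ {B i} p) refl
        ... | true = let (u , bu , a) = nbhd-elim B2 i e in
                     ⊥-elim (true≢false (trans (sym a) (sb u i (∧-elimˡ {B u} bu) (∧-elimˡ {B i} p))))

  NbhdMatching : BSet n → (Fin n → Fin n) → Set
  NbhdMatching S ψ = MatchingInto (nbhd S) S ψ

  matched-nbhd⇒Ψ : ∀ S f → StableB S → NbhdMatching S f → Ψᵇ S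
  matched-nbhd⇒Ψ S f st (mt , ad , ij) = MinSurplus⇒Ψ S st surplus
    where
    surplus : MinSurplus S
    surplus T sTS = subst₂ _≤_ (cong (size T +_) (sym e1)) (cong (_+ size (nbhd T)) (sym e2))
                      (rearrange (size T) (size (nbhd T)) (size (nbhd S ∖b nbhd T)) (size (S ∖b T)) le)
      where
      e1 = size-⊆-split (nbhd T) (nbhd S) (nbhd-mono T S sTS)
      e2 = size-⊆-split T S sTS
      rearrange : ∀ t nt d e → d ≤ e → t + (nt + d) ≤ (t + e) + nt
      rearrange t nt d e le = subst₂ _≤_ (+-assoc t nt d) (swap t nt e) (+-monoʳ-≤ (t + nt) le)
        where
        swap : ∀ t nt e → (t + nt) + e ≡ (t + e) + nt
        swap = solve-∀
      le : size (nbhd S ∖b nbhd T) ≤ size (S ∖b T)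
      le = injection⇒size≤ (nbhd S ∖b nbhd T) (S ∖b T) f m (λ i j p q → ij i j (∧-elimˡ {nbhd S i} p) (∧-elimˡ {nbhd S j} q))
        where
        m : MapsTo (nbhd S ∖b nbhd T) f (S ∖b T)
        m v p with T (f v) in e
        ... | false = ∧-intro (mt v (∧-elimˡ {nbhd S v} p)) refl
        ... | true = ⊥-elim (true-false-absurd (nbhd-intro T (f v) v e (adj-sym′ v (f v) (ad v (∧-elimˡ {nbhd S v} p)))) (not-elim (∧-elimʳ {nbhd S v} p)))

  graph : (Fin n → Fin n) → List (Fin n) → List (Fin n × Fin n)
  graph f L = map (λ v → (v , f v)) L

  graph-endpoint⁻ : ∀ f L w → w ∈ V (graph f L) → ∃ λ v → v ∈ L × (w ≡ v ⊎ w ≡ f v)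
  graph-endpoint⁻ f (v ∷ L) w (here refl) = v , here refl , inj₁ refl
  graph-endpoint⁻ f (v ∷ L) w (there (here refl)) = v , here refl , inj₂ refl
  graph-endpoint⁻ f (v ∷ L) w (there (there m)) = let (u , a , b) = graph-endpoint⁻ f L w m in u , there a , b

  ∈-graph⁻ : ∀ f L u w → (u , w) ∈ graph f L → u ∈ L × w ≡ f u
  ∈-graph⁻ f (v ∷ L) u w (here refl) = here refl , refl
  ∈-graph⁻ f (v ∷ L) u w (there m) = let (a , b) = ∈-graph⁻ f L u w m in there a , b

  ∈-graph⁺ : ∀ f L u → u ∈ L → (u , f u) ∈ graph f L
  ∈-graph⁺ f (v ∷ L) u (here refl) = here refl
  ∈-graph⁺ f (v ∷ L) u (there m) = there (∈-graph⁺ f L u m)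

  graph-endpoint⁺ : ∀ f L u → u ∈ L → u ∈ V (graph f L) × f u ∈ V (graph f L)
  graph-endpoint⁺ f (v ∷ L) u (here refl) = here refl , there (here refl)
  graph-endpoint⁺ f (v ∷ L) u (there m) = let (a , b) = graph-endpoint⁺ f L u m in there (there a) , there (there b)

  graph-isMatching : ∀ (D : BSet n) f → (∀ v → D v ≡ true → adj G v (f v) ≡ true) → InjectiveOn D f →
           (∀ u v → D u ≡ true → D v ≡ true → f u ≡ v → ⊥) →
           ∀ L → Unique L → (∀ v → v ∈ L → D v ≡ true) → IsMatching G (graph f L)
  graph-isMatching D f fadj finj fdisj [] u s = [] , []
  graph-isMatching D f fadj finj fdisj (v ∷ L) (a ∷ u) s =
    (fadj v (s v (here refl)) ∷ proj₁ rec) , (allv ∷ (allfv ∷ proj₂ rec))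
    where
    rec = graph-isMatching D f fadj finj fdisj L u (λ w m → s w (there m))
    Dv = s v (here refl)
    allv : All (λ y → ¬ v ≡ y) (f v ∷ V (graph f L))
    allv = (λ e → fdisj v v Dv Dv (sym e)) ∷ AllM.tabulate (λ {y} m e → lem y m e)
      where
      lem : ∀ y → y ∈ V (graph f L) → v ≡ y → ⊥
      lem y m e with graph-endpoint⁻ f L y m
      ... | (u' , mu , inj₁ q) = ∉-all a (subst (_∈ L) (sym (trans e q)) mu)
      ... | (u' , mu , inj₂ q) = fdisj u' v (s u' (there mu)) Dv (sym (trans e q))
    allfv : All (λ y → ¬ f v ≡ y) (V (graph f L))
    allfv = AllM.tabulate (λ {y} m e → lem y m e)
      where
      lem : ∀ y → y ∈ V (graph f L) → f v ≡ y → ⊥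
      lem y m e with graph-endpoint⁻ f L y m
      ... | (u' , mu , inj₁ q) = fdisj v u' Dv (s u' (there mu)) (trans e q)
      ... | (u' , mu , inj₂ q) = ∉-all a (subst (_∈ L) (sym (finj v u' Dv (s u' (there mu)) (trans e q))) mu)

  toMatching : BSet n → (Fin n → Fin n) → List (Fin n × Fin n)
  toMatching D f = graph f (elements D)

  length-toMatching : ∀ D f → length (toMatching D f) ≡ size D
  length-toMatching D f = trans (length-map _ (elements D)) (length-elements D)

  toMatching-isMatching : ∀ (D : BSet n) f → (∀ v → D v ≡ true → adj G v (f v) ≡ true) → InjectiveOn D f →
              (∀ u v → D u ≡ true → D v ≡ true → f u ≡ v → ⊥) → IsMatching G (toMatching D f)
  toMatching-isMatching D f fadj finj fdisj = graph-isMatching D f fadj finj fdisj (elements D) (elements-unique D) (elements⁻ D)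

  outerEnd : BSet n → Fin n × Fin n → Fin n
  outerEnd A (u , v) = if A u then v else u

  outerEnds-spec : ∀ A → StableB A → ∀ M → IsMatching G M →
           Unique (map (outerEnd A) M) × All (λ x → A x ≡ false) (map (outerEnd A) M) × All (λ x → x ∈ V M) (map (outerEnd A) M)
  outerEnds-spec A st [] _ = [] , [] , []
  outerEnds-spec A st ((u , v) ∷ M) (auv ∷ al , (hu ∷ (hv ∷ un))) =
    (AllM.tabulate (λ {y} m e → notin y m e) ∷ r1) , (pkA ∷ r2) , (pkE ∷ AllM.map (λ m → there (there m)) r3)
    where
    rec = outerEnds-spec A st M (al , un)
    r1 = proj₁ rec
    r2 = proj₁ (proj₂ rec)
    r3 = proj₂ (proj₂ rec)
    pkE : outerEnd A (u , v) ∈ u ∷ v ∷ V M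
    pkE with A u
    ... | true = there (here refl)
    ... | false = here refl
    pkA : A (outerEnd A (u , v)) ≡ false
    pkA with A u in e
    ... | false = e
    ... | true with A v in e2
    ... | false = refl
    ... | true = ⊥-elim (true≢false (trans (sym auv) (st u v e e2)))
    notin : ∀ y → y ∈ map (outerEnd A) M → outerEnd A (u , v) ≡ y → ⊥
    notin y m e with A u
    ... | true = ∉-all hv (subst (_∈ V M) (sym e) (AllM.lookup r3 m))
    ... | false = ∉-all (proj₂ (AllM.uncons hu)) (subst (_∈ V M) (sym e) (AllM.lookup r3 m))

  matching+stable≤n : ∀ M A → IsMatching G M → StableB A → length M + size A ≤ n
  matching+stable≤n M A im st = subst (_≤ n) (+-comm (size A) (length M))
    (subst (size A + length M ≤_) (size-complement A)
      (+-monoʳ-≤ (size A) (subst (_≤ size (∁b A)) (length-map (outerEnd A) M)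
        (unique-list-size≤ (map (outerEnd A) M) (∁b A) (proj₁ r) (AllM.map not-intro (proj₁ (proj₂ r)))))))
    where r = outerEnds-spec A st M im

  outerEndpoints : BSet n → List (Fin n × Fin n) → List (Fin n)
  outerEndpoints A M = filter (λ v → A v BoolP.≟ false) (V M)

  outerEndpoints-outside : ∀ A M → All (λ v → ∁b A v ≡ true) (outerEndpoints A M)
  outerEndpoints-outside A M = AllM.tabulate (λ m → not-intro (proj₂ (∈-filter⁻ (λ v → A v BoolP.≟ false) {xs = V M} m)))

  length≤outerEndpoints : ∀ A → StableB A → ∀ M → IsMatching G M → length M ≤ length (outerEndpoints A M)
  length≤outerEndpoints A st [] _ = z≤n
  length≤outerEndpoints A st ((u , v) ∷ M) (auv ∷ al , (_ ∷ (_ ∷ un))) with A u in eu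
  ... | true with A v in ev
  ...   | true = ⊥-elim (true≢false (trans (sym auv) (st u v eu ev)))
  ...   | false = s≤s (length≤outerEndpoints A st M (al , un))
  length≤outerEndpoints A st ((u , v) ∷ M) (auv ∷ al , (_ ∷ (_ ∷ un))) | false with A v in ev
  ...   | true = s≤s (length≤outerEndpoints A st M (al , un))
  ...   | false = s≤s (m≤n⇒m≤1+n (length≤outerEndpoints A st M (al , un)))

  length<outerEndpoints : ∀ A → StableB A → ∀ M → IsMatching G M → ∀ u v → (u , v) ∈ M → A u ≡ false → A v ≡ false →
                suc (length M) ≤ length (outerEndpoints A M)
  length<outerEndpoints A st ((a , b) ∷ M) (aab ∷ al , (_ ∷ (_ ∷ un))) u v (here refl) eu ev rewrite eu | ev =
    s≤s (s≤s (length≤outerEndpoints A st M (al , un)))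
  length<outerEndpoints A st ((a , b) ∷ M) (aab ∷ al , (_ ∷ (_ ∷ un))) u v (there m) eu ev with A a in ea
  ... | true with A b in eb
  ...   | true = ⊥-elim (true≢false (trans (sym aab) (st a b ea eb)))
  ...   | false = s≤s (length<outerEndpoints A st M (al , un) u v m eu ev)
  length<outerEndpoints A st ((a , b) ∷ M) (aab ∷ al , (_ ∷ (_ ∷ un))) u v (there m) eu ev | false with A b in eb
  ...   | true = s≤s (length<outerEndpoints A st M (al , un) u v m eu ev)
  ...   | false = s≤s (m≤n⇒m≤1+n (length<outerEndpoints A st M (al , un) u v m eu ev))

  -- When |M| + |A| = n, only |M| vertices lie outside A, while the edges of M have at
  -- least |M| endpoints there, one more for each edge missing A.
  module Balanced (M : List (Fin n × Fin n)) (A : BSet n) (im : IsMatching G M) (st : StableB A)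
            (eq : length M + size A ≡ n) where
    size-outside : size (∁b A) ≡ length M
    size-outside = +-cancelʳ-≡ (size A) (size (∁b A)) (length M)
           (trans (+-comm (size (∁b A)) (size A)) (trans (size-complement A) (sym eq)))

    length-outerEndpoints≤ : length (outerEndpoints A M) ≤ length M
    length-outerEndpoints≤ = subst (length (outerEndpoints A M) ≤_) size-outside
            (unique-list-size≤ (outerEndpoints A M) (∁b A) (Unique.filter⁺ _ (proj₂ im)) (outerEndpoints-outside A M))

    edge-meets : ∀ u v → (u , v) ∈ M → A u ≡ true ⊎ A v ≡ true
    edge-meets u v m with A u in eu | A v in ev
    ... | true | _ = inj₁ refl
    ... | false | true = inj₂ refl
    ... | false | false = ⊥-elim (<-irrefl refl (≤-trans (length<outerEndpoints A st M im u v m eu ev) length-outerEndpoints≤))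

    covers : ∀ v → A v ≡ false → v ∈ V M
    covers v av = proj₁ (∈-filter⁻ (λ v → A v BoolP.≟ false) {xs = V M}
      (unique-list-covers (outerEndpoints A M) (∁b A) (Unique.filter⁺ _ (proj₂ im)) (outerEndpoints-outside A M)
           (subst (_≤ length (outerEndpoints A M)) (sym size-outside) (length≤outerEndpoints A st M im)) v (not-intro av)))

  partner : List (Fin n × Fin n) → Fin n → Fin n
  partner [] v = v
  partner ((a , b) ∷ M) v = if eqF v a then b else (if eqF v b then a else partner M v)

  edge-endpoints : ∀ M a b → (a , b) ∈ M → a ∈ V M × b ∈ V M
  edge-endpoints ((x , y) ∷ M) a b (here refl) = here refl , there (here refl)
  edge-endpoints ((x , y) ∷ M) a b (there m) = let (p , q) = edge-endpoints M a b m in there (there p) , there (there q)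

  endpoint-edge : ∀ M w → w ∈ V M → ∃ λ a → ∃ λ b → (a , b) ∈ M × (w ≡ a ⊎ w ≡ b)
  endpoint-edge ((x , y) ∷ M) w (here refl) = x , y , here refl , inj₁ refl
  endpoint-edge ((x , y) ∷ M) w (there (here refl)) = x , y , here refl , inj₂ refl
  endpoint-edge ((x , y) ∷ M) w (there (there m)) = let (a , b , p , q) = endpoint-edge M w m in a , b , there p , q

  partner-edge : ∀ M → Unique (V M) → ∀ a b → (a , b) ∈ M → partner M a ≡ b × partner M b ≡ a
  partner-edge ((x , y) ∷ M) (hx ∷ (hy ∷ u)) a b (here refl) rewrite eqF-refl a
    | ≢⇒eqF-false {i = b} {a} (λ e → proj₁ (AllM.uncons hx) (sym e)) | eqF-refl b = refl , refl
  partner-edge ((x , y) ∷ M) (hx ∷ (hy ∷ u)) a b (there m)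
    rewrite ≢⇒eqF-false {i = a} {x} (λ e → ∉-all (proj₂ (AllM.uncons hx)) (subst (_∈ V M) e (proj₁ (edge-endpoints M a b m))))
          | ≢⇒eqF-false {i = a} {y} (λ e → ∉-all hy (subst (_∈ V M) e (proj₁ (edge-endpoints M a b m))))
          | ≢⇒eqF-false {i = b} {x} (λ e → ∉-all (proj₂ (AllM.uncons hx)) (subst (_∈ V M) e (proj₂ (edge-endpoints M a b m))))
          | ≢⇒eqF-false {i = b} {y} (λ e → ∉-all hy (subst (_∈ V M) e (proj₂ (edge-endpoints M a b m))))
    = partner-edge M u a b m

  partner-∈ : ∀ M → Unique (V M) → ∀ w → w ∈ V M → (w , partner M w) ∈ M ⊎ (partner M w , w) ∈ M
  partner-∈ M u w m with endpoint-edge M w m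
  ... | (a , b , p , inj₁ refl) = inj₁ (subst (λ z → (w , z) ∈ M) (sym (proj₁ (partner-edge M u a b p))) p)
  ... | (a , b , p , inj₂ refl) = inj₂ (subst (λ z → (z , w) ∈ M) (sym (proj₂ (partner-edge M u a b p))) p)

  partner-involutive : ∀ M → Unique (V M) → ∀ w → w ∈ V M → partner M (partner M w) ≡ w
  partner-involutive M u w m with partner-∈ M u w m
  ... | inj₁ p = proj₂ (partner-edge M u w (partner M w) p)
  ... | inj₂ p = proj₁ (partner-edge M u (partner M w) w p)

  partner-endpoint : ∀ M → Unique (V M) → ∀ w → w ∈ V M → partner M w ∈ V M
  partner-endpoint M u w m with partner-∈ M u w m
  ... | inj₁ p = proj₂ (edge-endpoints M w (partner M w) p)
  ... | inj₂ p = proj₁ (edge-endpoints M (partner M w) w p)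

  partner-injective : ∀ M → Unique (V M) → ∀ v w → v ∈ V M → w ∈ V M → partner M v ≡ partner M w → v ≡ w
  partner-injective M u v w mv mw e = trans (sym (partner-involutive M u v mv)) (trans (cong (partner M) e) (partner-involutive M u w mw))

  edge-adj : ∀ M → IsMatching G M → ∀ a b → (a , b) ∈ M → adj G a b ≡ true
  edge-adj ((x , y) ∷ M) (axy ∷ al , _ ∷ un) a b (here refl) = axy
  edge-adj ((x , y) ∷ M) (axy ∷ al , _ ∷ (_ ∷ un)) a b (there m) = edge-adj M (al , un) a b m

  partner-adj : ∀ M → IsMatching G M → ∀ w → w ∈ V M → adj G w (partner M w) ≡ true
  partner-adj M im w m with partner-∈ M (proj₂ im) w m
  ... | inj₁ p = edge-adj M im w (partner M w) p
  ... | inj₂ p = trans (adj-sym G w (partner M w)) (edge-adj M im (partner M w) w p)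

  Stable⇒StableB : ∀ p → Stable G p → StableB (toBSet p)
  Stable⇒StableB p st u v a b = st u v (toBSet⇒∈ a) (toBSet⇒∈ b)

  StableB⇒Stable : ∀ p → StableB (toBSet p) → Stable G p
  StableB⇒Stable p st u v a b = st u v (∈⇒toBSet a) (∈⇒toBSet b)

  Ψ⇒Ψᵇ : ∀ p → Ψ G p → Ψᵇ (toBSet p)
  Ψ⇒Ψᵇ p (st , mx) = Stable⇒StableB p st , λ B sb inb →
    subst₂ _≤_ (trans (∣∣≡size (toSubset B)) (size-cong _ _ (toBSet-toSubset B))) (∣∣≡size p)
      (mx (toSubset B) (StableB⇒Stable (toSubset B) (λ u v a b → sb u v (trans (sym (toBSet-toSubset B u)) a) (trans (sym (toBSet-toSubset B v)) b)))
          (λ v m → tr v (inb v (trans (sym (toBSet-toSubset B v)) (∈⇒toBSet m)))))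
    where
    tr : ∀ v → InClosedNbhdᵇ (toBSet p) v → InClosedNbhd G p v
    tr v (inj₁ q) = inj₁ (toBSet⇒∈ q)
    tr v (inj₂ (u , q , a)) = inj₂ (u , toBSet⇒∈ q , a)

  Ψᵇ⇒Ψ : ∀ p → Ψᵇ (toBSet p) → Ψ G p
  Ψᵇ⇒Ψ p (st , mx) = StableB⇒Stable p st , λ B sb inb →
    subst₂ _≤_ (sym (∣∣≡size B)) (sym (∣∣≡size p)) (mx (toBSet B) (Stable⇒StableB B sb) (λ v m → tr v (inb v (toBSet⇒∈ m))))
    where
    tr : ∀ v → InClosedNbhd G p v → InClosedNbhdᵇ (toBSet p) v
    tr v (inj₁ q) = inj₁ (∈⇒toBSet q)
    tr v (inj₂ (u , q , a)) = inj₂ (u , ∈⇒toBSet q , a)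

  Ψᵇ⇒Ψ-toSubset : ∀ A → Ψᵇ A → Ψ G (toSubset A)
  Ψᵇ⇒Ψ-toSubset A ps = Ψᵇ⇒Ψ (toSubset A) (Ψᵇ-cong A (toBSet (toSubset A)) (λ i → sym (toBSet-toSubset A i)) ps)

  Ψᵇ-accessible : IsGreedoid (Ψ G) → ∀ A → Ψᵇ A → (∃ λ x → A x ≡ true) → ∃ λ x → A x ≡ true × Ψᵇ (A -b x)
  Ψᵇ-accessible gr A ps (x , ax) =
    let (y , my , py) = IsGreedoid.accessible gr (toSubset A) (Ψᵇ⇒Ψ-toSubset A ps) (x , toBSet⇒∈ (trans (toBSet-toSubset A x) ax))
    in y , trans (sym (toBSet-toSubset A y)) (∈⇒toBSet my) ,
       Ψᵇ-cong _ _ (λ i → trans (lookup-minus (toSubset A) y i) (cong (λ z → z ∧ not (eqF i y)) (toBSet-toSubset A i))) (Ψ⇒Ψᵇ _ py)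

  greedoid-from-Ψᵇ : (∀ A → Ψᵇ A → (∃ λ x → A x ≡ true) → ∃ λ x → A x ≡ true × Ψᵇ (A -b x)) →
               (∀ X Y → Ψᵇ X → Ψᵇ Y → size X ≡ suc (size Y) →
                  ∃ λ x → X x ≡ true × Y x ≡ false × Ψᵇ (Y ∪b ⁅ x ⁆b)) →
               IsGreedoid (Ψ G)
  greedoid-from-Ψᵇ acc exch = record { accessible = ac ; exchange = ex }
    where
    ac : ∀ X → Ψ G X → Nonempty X → ∃ λ x → x ∈s X × Ψ G (X -s x)
    ac X ψ (x , m) = let (y , my , py) = acc (toBSet X) (Ψ⇒Ψᵇ X ψ) (x , ∈⇒toBSet m) in
      y , toBSet⇒∈ my , Ψᵇ⇒Ψ (X -s y) (Ψᵇ-cong _ _ (λ i → sym (lookup-minus X y i)) py)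
    ex : ∀ X Y → Ψ G X → Ψ G Y → ∣ X ∣ ≡ suc ∣ Y ∣ → ∃ λ x → x ∈s X × x ∉s Y × Ψ G (Y ∪s ⁅ x ⁆)
    ex X Y ψx ψy e = let (x , mx , nx , px) = exch (toBSet X) (toBSet Y) (Ψ⇒Ψᵇ X ψx) (Ψ⇒Ψᵇ Y ψy)
                                                  (trans (sym (∣∣≡size X)) (trans e (cong suc (∣∣≡size Y)))) in
      x , toBSet⇒∈ mx , (λ m → true≢false (trans (sym (∈⇒toBSet m)) nx)) ,
      Ψᵇ⇒Ψ (Y ∪s ⁅ x ⁆) (Ψᵇ-cong _ _ (λ i → sym (lookup-∪⁅⁆ Y x i)) px)

module BipartiteGraph {n : ℕ} (G : Graph n) (col : Fin n → Bool)
            (bip : ∀ u v → adj G u v ≡ true → col u ≡ col v → ⊥) where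

  open GraphBasics G public
  open AlternativeMatching (adj G)

  side : Bool → BSet n
  side true v = col v
  side false v = not (col v)

  side-adj : ∀ b u v → adj G u v ≡ true → side b u ≡ true → side b v ≡ false
  side-adj true u v a cu with col v in e
  ... | true = ⊥-elim (bip u v a (trans cu (sym e)))
  ... | false = refl
  side-adj false u v a cu with col v in e | col u in e2
  ... | false | false = ⊥-elim (bip u v a (trans e2 (sym e)))
  ... | true | _ = refl
  ... | false | true = ⊥-elim (true≢false (sym cu))

  side-stable : ∀ A b → A ⊆b side b → StableB A
  side-stable A b s u v p q with adj G u v in e
  ... | false = refl
  ... | true = ⊥-elim (true-false-absurd (s v q) (side-adj b u v e (s u p)))

  nbhd-other-side : ∀ S b v → S ⊆b side b → nbhd S v ≡ true → side b v ≡ false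
  nbhd-other-side S b v s p = let (u , su , a) = nbhd-elim S v p in side-adj b u v a (s u su)

  other-side-adj : ∀ b u v → adj G u v ≡ true → side b u ≡ false → side b v ≡ true
  other-side-adj true u v a cu with col v in e
  ... | true = refl
  ... | false = ⊥-elim (bip u v a (trans cu (sym e)))
  other-side-adj false u v a cu with col v in e | col u in e2
  ... | true | true = ⊥-elim (bip u v a (trans e2 (sym e)))
  ... | false | _ = refl
  ... | true | false = ⊥-elim (true≢false cu)

  other-side-stable : ∀ A b → A ⊆b ∁b (side b) → StableB A
  other-side-stable A b s u v p q with adj G u v in e
  ... | false = refl
  ... | true = ⊥-elim (true-false-absurd (other-side-adj b u v e (not-elim (s u p))) (not-elim (s v q)))

  -- T ∩ side b, S ∖ side b and N(S ∩ side b) ∖ N(T ∩ side b) form a stable subset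
  -- of N[S] (the last part lies on the other side), so it is no larger than S.
  module SurplusWitness (b : Bool) (S T : BSet n) (st : StableB S) (sTS : T ⊆b S) where
    Tb = T ∩b side b
    Sb = S ∩b side b
    Sn = S ∖b side b
    Nd = nbhd Sb ∖b nbhd Tb
    B = Tb ∪b (Sn ∪b Nd)
    sTbS : Tb ⊆b S
    sTbS i p = sTS i (∧-elimˡ {T i} p)
    sSbS : Sb ⊆b S
    sSbS i p = ∧-elimˡ {S i} p
    nd-col : ∀ v → Nd v ≡ true → side b v ≡ false
    nd-col v p = nbhd-other-side Sb b v (λ i q → ∧-elimʳ {S i} q) (∧-elimˡ {nbhd Sb v} p)
    nd-out : ∀ v → Nd v ≡ true → S v ≡ false
    nd-out v p = stable-nbhd-outside S v st (nbhd-mono Sb S sSbS v (∧-elimˡ {nbhd Sb v} p))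
    stB : StableB B
    stB = stable-∪ Tb (Sn ∪b Nd) (stable-⊆ Tb S sTbS st)
            (stable-∪ Sn Nd (stable-⊆ Sn S (λ i q → ∧-elimˡ {S i} q) st)
               (other-side-stable Nd b (λ i q → not-intro (nd-col i q)))
               (λ u v p q a → true-false-absurd (other-side-adj b u v a (not-elim (∧-elimʳ {S u} p))) (nd-col v q)))
            cr
      where
      cr : ∀ u v → Tb u ≡ true → (Sn ∪b Nd) v ≡ true → adj G u v ≡ true → ⊥
      cr u v p q a with ∨-elim {Sn v} q
      ... | inj₁ q' = true≢false (trans (sym a) (st u v (sTbS u p) (∧-elimˡ {S v} q')))
      ... | inj₂ q' = true-false-absurd (nbhd-intro Tb u v p a) (not-elim (∧-elimʳ {nbhd Sb v} q'))
    inB : ∀ v → B v ≡ true → InClosedNbhdᵇ S v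
    inB v p with ∨-elim {Tb v} p
    ... | inj₁ q = inj₁ (sTbS v q)
    ... | inj₂ q with ∨-elim {Sn v} q
    ... | inj₁ r = inj₁ (∧-elimˡ {S v} r)
    ... | inj₂ r = let (u , su , a) = nbhd-elim Sb v (∧-elimˡ {nbhd Sb v} r) in inj₂ (u , sSbS u su , a)
    eB : size B ≡ size Tb + (size Sn + size Nd)
    eB = trans (size-disjoint-∪ Tb (Sn ∪b Nd) d1) (cong (size Tb +_) (size-disjoint-∪ Sn Nd d2))
      where
      d1 : ∀ i → Tb i ≡ true → (Sn ∪b Nd) i ≡ true → ⊥
      d1 i p q with ∨-elim {Sn i} q
      ... | inj₁ q' = true-false-absurd (∧-elimʳ {T i} p) (not-elim (∧-elimʳ {S i} q'))
      ... | inj₂ q' = true-false-absurd (∧-elimʳ {T i} p) (nd-col i q')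
      d2 : ∀ i → Sn i ≡ true → Nd i ≡ true → ⊥
      d2 i p q = true-false-absurd (∧-elimˡ {S i} p) (nd-out i q)

  Ψ⇒MinSurplus-side : ∀ b S T → Ψᵇ S → T ⊆b S →
            size (T ∩b side b) + size (nbhd (S ∩b side b)) ≤ size (S ∩b side b) + size (nbhd (T ∩b side b))
  Ψ⇒MinSurplus-side b S T (st , mx) sTS = subst (λ z → size Tb + z ≤ size Sb + size (nbhd Tb))
      (sym (size-⊆-split (nbhd Tb) (nbhd Sb) (nbhd-mono Tb Sb (λ i q → ∧-intro (sTS i (∧-elimˡ {T i} q)) (∧-elimʳ {T i} q)))))
      (rearrange (size Tb) (size Sn) (size Nd) (size Sb) (size (nbhd Tb))
      (subst₂ _≤_ eB (size-split S (side b)) (mx B stB inB)))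
    where
    open SurplusWitness b S T st sTS
    rearrange : ∀ t s2 d s1 m → t + (s2 + d) ≤ s1 + s2 → t + (m + d) ≤ s1 + m
    rearrange t s2 d s1 m h = subst (_≤ s1 + m) (sym (swap t m d))
      (+-monoˡ-≤ m (+-cancelʳ-≤ s2 (t + d) s1 (subst (_≤ s1 + s2) (swap t s2 d) h)))
      where
      swap : ∀ t s d → t + (s + d) ≡ (t + d) + s
      swap = solve-∀

  nbhd-size-by-side : ∀ X → size (nbhd X) ≡ size (nbhd (X ∩b side true)) + size (nbhd (X ∩b side false))
  nbhd-size-by-side X = trans (size-cong (nbhd X) (nbhd (X ∩b side true) ∪b nbhd (X ∩b side false)) e)
                        (size-disjoint-∪ _ _ d)
    where
    e : ∀ v → nbhd X v ≡ (nbhd (X ∩b side true) ∪b nbhd (X ∩b side false)) v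
    e v with nbhd X v in p
    ... | true = sym (let (u , xu , a) = nbhd-elim X v p in h u xu a)
      where
      h : ∀ u → X u ≡ true → adj G u v ≡ true → (nbhd (X ∩b side true) ∪b nbhd (X ∩b side false)) v ≡ true
      h u xu a with col u in cu
      ... | true = ∨-introˡ (nbhd-intro (X ∩b side true) u v (∧-intro xu cu) a)
      ... | false = ∨-introʳ {nbhd (X ∩b side true) v} (nbhd-intro (X ∩b side false) u v (∧-intro xu (not-intro cu)) a)
    ... | false = sym (trans (cong₂ _∨_ (nbhd-false (X ∩b side true) v (λ u q a → true-false-absurd (nbhd-intro X u v (∧-elimˡ {X u} q) a) p))
                                        (nbhd-false (X ∩b side false) v (λ u q a → true-false-absurd (nbhd-intro X u v (∧-elimˡ {X u} q) a) p))) refl)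
    d : ∀ i → nbhd (X ∩b side true) i ≡ true → nbhd (X ∩b side false) i ≡ true → ⊥
    d i p q = true-false-absurd (other-side-adj true _ i (proj₂ (proj₂ (nbhd-elim _ i q))) (not-elim (∧-elimʳ {X (proj₁ (nbhd-elim _ i q))} (proj₁ (proj₂ (nbhd-elim _ i q))))))
                      (nbhd-other-side (X ∩b side true) true i (λ j r → ∧-elimʳ {X j} r) p)

  Ψ⇒MinSurplus : ∀ S → Ψᵇ S → MinSurplus S
  Ψ⇒MinSurplus S ps T sTS = subst₂ _≤_ (sym (cong₂ _+_ (size-split T (side true)) (nbhd-size-by-side S)))
                               (sym (cong₂ _+_ (size-split S (side true)) (nbhd-size-by-side T)))
                         (+-mono-≤-interchange (size (T ∩b side true)) (size (nbhd (S ∩b side true))) (size (S ∩b side true)) (size (nbhd (T ∩b side true)))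
                                 (size (T ∩b side false)) (size (nbhd (S ∩b side false))) (size (S ∩b side false)) (size (nbhd (T ∩b side false)))
                            (Ψ⇒MinSurplus-side true S T ps sTS) (Ψ⇒MinSurplus-side false S T ps sTS))
    where
    +-mono-≤-interchange : ∀ a b c d e f g h → a + b ≤ c + d → e + f ≤ g + h → (a + e) + (b + f) ≤ (c + g) + (d + h)
    +-mono-≤-interchange a b c d e f g h p q =
      subst₂ _≤_ (interchange a b e f) (interchange c d g h) (+-mono-≤ p q)

  -- A matching inside U, given by the set D of its ends on one side and the partner map f,
  -- together with a stable A ⊆ U such that |D| + |A| = |U|.
  record KönigEgerváry (U : BSet n) : Set where
    field
      D : BSet n
      f : Fin n → Fin n
      A : BSet n
      DU : D ⊆b U
      fU : MapsTo D f U
      fadj : ∀ v → D v ≡ true → adj G v (f v) ≡ true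
      finj : InjectiveOn D f
      fdisj : ∀ u v → D u ≡ true → D v ≡ true → f u ≡ v → ⊥
      AU : A ⊆b U
      Ast : StableB A
      count : size D + size A ≡ size U

  -- For Ts of maximal deficiency |T| - |N(T) ∩ YU| among T ⊆ XU, Hall's condition
  -- holds both for XU ∖ Ts into YU ∖ N(Ts) and for N(Ts) ∩ YU into Ts; the two
  -- matchings together with the stable set Ts ∪ (YU ∖ N(Ts)) cover U exactly.
  module KönigConstruction (U Ts : BSet n) (sT : Ts ⊆b (U ∩b side true))
    (hmax : ∀ T → T ⊆b (U ∩b side true) →
            size T + size (nbhd Ts ∩b (U ∖b side true)) ≤ size Ts + size (nbhd T ∩b (U ∖b side true))) where
    XU = U ∩b side true
    YU = U ∖b side true
    N = size (nbhd Ts ∩b YU)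
    X1 = XU ∖b Ts
    Y1 = YU ∖b nbhd Ts
    X2 = nbhd Ts ∩b YU
    D = X1 ∪b X2
    A = Ts ∪b Y1
    hall₁ : HallCondition X1 Y1
    hall₁ R sR = cancel (size Ts) (size R) N (size (nbhd R ∩b Y1))
        (≤-trans (subst (λ z → z + N ≤ size Ts + size (nbhd (Ts ∪b R) ∩b YU)) eR (hmax (Ts ∪b R) sub))
           (+-monoʳ-≤ (size Ts) (≤-trans (size-mono _ ((nbhd Ts ∩b YU) ∪b (nbhd R ∩b Y1)) inc) (size-∪-≤ (nbhd Ts ∩b YU) (nbhd R ∩b Y1)))))
      where
      cancel : ∀ t r N c → (t + r) + N ≤ t + (N + c) → r ≤ c
      cancel t r N c h = +-cancelʳ-≤ (t + N) r c (subst₂ _≤_ (swap₁ t r N) (swap₂ t N c) h)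
        where
        swap₁ : ∀ t r N → (t + r) + N ≡ r + (t + N)
        swap₁ = solve-∀
        swap₂ : ∀ t N c → t + (N + c) ≡ c + (t + N)
        swap₂ = solve-∀
      eR : size (Ts ∪b R) ≡ size Ts + size R
      eR = size-disjoint-∪ Ts R (λ i p q → true-false-absurd p (not-elim (∧-elimʳ {XU i} (sR i q))))
      sub : (Ts ∪b R) ⊆b XU
      sub i p with ∨-elim {Ts i} p
      ... | inj₁ q = sT i q
      ... | inj₂ q = ∧-elimˡ {XU i} (sR i q)
      inc : (nbhd (Ts ∪b R) ∩b YU) ⊆b ((nbhd Ts ∩b YU) ∪b (nbhd R ∩b Y1))
      inc v p with nbhd Ts v in e
      ... | true = ∨-introˡ (∧-intro refl (∧-elimʳ {nbhd (Ts ∪b R) v} p))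
      ... | false = ∨-introʳ {false ∧ YU v} (∧-intro (let (u , uTR , a) = nbhd-elim (Ts ∪b R) v (∧-elimˡ {nbhd (Ts ∪b R) v} p) in
                        cu u uTR a) (∧-intro (∧-elimʳ {nbhd (Ts ∪b R) v} p) refl))
        where
        cu : ∀ u → (Ts ∪b R) u ≡ true → adj G u v ≡ true → nbhd R v ≡ true
        cu u uTR a with ∨-elim {Ts u} uTR
        ... | inj₁ q = ⊥-elim (true-false-absurd (nbhd-intro Ts u v q a) e)
        ... | inj₂ q = nbhd-intro R u v q a
    hall₂ : HallCondition X2 Ts
    hall₂ Q sQ = subst (size Q ≤_) (size-cong _ _ (λ i → BoolP.∧-comm (Ts i) (nbhd Q i)))
        (cancel (size T') N (size (Ts ∩b nbhd Q)) (size (nbhd T' ∩b YU)) (size Q)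
          (subst (λ z → size T' + N ≤ z + size (nbhd T' ∩b YU)) (size-split Ts (nbhd Q)) (hmax T' (λ i p → sT i (∧-elimˡ {Ts i} p))))
          k)
      where
      cancel : ∀ t' N tq m q → t' + N ≤ (tq + t') + m → m + q ≤ N → q ≤ tq
      cancel t' N tq m q h k = +-cancelʳ-≤ (t' + m) q tq
        (subst₂ _≤_ (swap₁ t' m q) (+-assoc tq t' m)
          (≤-trans (subst (_≤ t' + N) (sym (+-assoc t' m q)) (+-monoʳ-≤ t' k)) h))
        where
        swap₁ : ∀ t' m q → (t' + m) + q ≡ q + (t' + m)
        swap₁ = solve-∀
      T' = Ts ∖b nbhd Q
      k : size (nbhd T' ∩b YU) + size Q ≤ N
      k = subst (_≤ N) (size-disjoint-∪ (nbhd T' ∩b YU) Q d) (size-mono _ _ sub)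
        where
        d : ∀ i → (nbhd T' ∩b YU) i ≡ true → Q i ≡ true → ⊥
        d i p q = let (t , tt , a) = nbhd-elim T' i (∧-elimˡ {nbhd T' i} p) in
                  true-false-absurd (nbhd-intro Q i t q (adj-sym′ t i a)) (not-elim (∧-elimʳ {Ts t} tt))
        sub : ((nbhd T' ∩b YU) ∪b Q) ⊆b X2
        sub i p with ∨-elim {(nbhd T' ∩b YU) i} p
        ... | inj₁ q = ∧-intro (nbhd-mono T' Ts (λ j r → ∧-elimˡ {Ts j} r) i (∧-elimˡ {nbhd T' i} q)) (∧-elimʳ {nbhd T' i} q)
        ... | inj₂ q = sQ i q
    r1 = hall X1 Y1 hall₁
    r2 = hall X2 Ts hall₂
    f1 = proj₁ r1
    f2 = proj₁ r2
    f : Fin n → Fin n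
    f = piecewise col f1 f2
    x1-col : ∀ v → X1 v ≡ true → col v ≡ true
    x1-col v p = ∧-elimʳ {U v} (∧-elimˡ {XU v} p)
    x2-col : ∀ v → X2 v ≡ true → col v ≡ false
    x2-col v p = not-elim (∧-elimʳ {U v} (∧-elimʳ {nbhd Ts v} p))
    D-t : ∀ v → D v ≡ true → col v ≡ true → X1 v ≡ true
    D-t v p c with ∨-elim {X1 v} p
    ... | inj₁ q = q
    ... | inj₂ q = ⊥-elim (true≢false (trans (sym c) (x2-col v q)))
    D-f : ∀ v → D v ≡ true → col v ≡ false → X2 v ≡ true
    D-f v p c with ∨-elim {X1 v} p
    ... | inj₁ q = ⊥-elim (true≢false (trans (sym (x1-col v q)) c))
    ... | inj₂ q = q
    f1Y : ∀ v → X1 v ≡ true → Y1 (f1 v) ≡ true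
    f1Y v p = proj₁ (proj₂ r1) v p
    f2T : ∀ v → X2 v ≡ true → Ts (f2 v) ≡ true
    f2T v p = proj₁ (proj₂ r2) v p
    y1-col : ∀ v → Y1 v ≡ true → col v ≡ false
    y1-col v p = not-elim (∧-elimʳ {U v} (∧-elimˡ {YU v} p))
    ts-col : ∀ v → Ts v ≡ true → col v ≡ true
    ts-col v p = ∧-elimʳ {U v} (sT v p)
    DU : D ⊆b U
    DU v p with ∨-elim {X1 v} p
    ... | inj₁ q = ∧-elimˡ {U v} (∧-elimˡ {XU v} q)
    ... | inj₂ q = ∧-elimˡ {U v} (∧-elimʳ {nbhd Ts v} q)
    f-t : ∀ v → col v ≡ true → f v ≡ f1 v
    f-t v c = piecewise-true col f1 f2 v c
    f-f : ∀ v → col v ≡ false → f v ≡ f2 v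
    f-f v c = piecewise-false col f1 f2 v c
    fU : MapsTo D f U
    fU v p with true-or-false (col v)
    ... | inj₁ c = subst (λ z → U z ≡ true) (sym (f-t v c)) (∧-elimˡ {U (f1 v)} (∧-elimˡ {YU (f1 v)} (f1Y v (D-t v p c))))
    ... | inj₂ c = subst (λ z → U z ≡ true) (sym (f-f v c)) (∧-elimˡ {U (f2 v)} (sT (f2 v) (f2T v (D-f v p c))))
    fadj : ∀ v → D v ≡ true → adj G v (f v) ≡ true
    fadj v p with true-or-false (col v)
    ... | inj₁ c = subst (λ z → adj G v z ≡ true) (sym (f-t v c)) (proj₁ (proj₂ (proj₂ r1)) v (D-t v p c))
    ... | inj₂ c = subst (λ z → adj G v z ≡ true) (sym (f-f v c)) (proj₁ (proj₂ (proj₂ r2)) v (D-f v p c))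
    finj : InjectiveOn D f
    finj u v p q e with true-or-false (col u) | true-or-false (col v)
    ... | inj₁ cu | inj₁ cv = proj₂ (proj₂ (proj₂ r1)) u v (D-t u p cu) (D-t v q cv) (trans (sym (f-t u cu)) (trans e (f-t v cv)))
    ... | inj₂ cu | inj₂ cv = proj₂ (proj₂ (proj₂ r2)) u v (D-f u p cu) (D-f v q cv) (trans (sym (f-f u cu)) (trans e (f-f v cv)))
    ... | inj₁ cu | inj₂ cv = ⊥-elim (true≢false (trans (sym (ts-col (f2 v) (f2T v (D-f v q cv))))
                             (trans (cong col (sym (trans (sym (f-t u cu)) (trans e (f-f v cv))))) (y1-col (f1 u) (f1Y u (D-t u p cu))))))
    ... | inj₂ cu | inj₁ cv = ⊥-elim (true≢false (trans (sym (ts-col (f2 u) (f2T u (D-f u p cu))))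
                             (trans (cong col (trans (sym (f-f u cu)) (trans e (f-t v cv)))) (y1-col (f1 v) (f1Y v (D-t v q cv))))))
    fdisj : ∀ u v → D u ≡ true → D v ≡ true → f u ≡ v → ⊥
    fdisj u v p q e with true-or-false (col u) | true-or-false (col v)
    ... | inj₁ cu | inj₁ cv = true≢false (trans (sym cv) (trans (cong col (sym (trans (sym (f-t u cu)) e))) (y1-col (f1 u) (f1Y u (D-t u p cu)))))
    ... | inj₁ cu | inj₂ cv = true-false-absurd (subst (λ z → nbhd Ts z ≡ true) (sym (trans (sym (f-t u cu)) e)) (∧-elimˡ {nbhd Ts v} (D-f v q cv)))
                                 (not-elim (∧-elimʳ {YU (f1 u)} (f1Y u (D-t u p cu))))
    ... | inj₂ cu | inj₁ cv = true-false-absurd (subst (λ z → Ts z ≡ true) (trans (sym (f-f u cu)) e) (f2T u (D-f u p cu))) (not-elim (∧-elimʳ {XU v} (D-t v q cv)))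
    ... | inj₂ cu | inj₂ cv = true≢false (trans (sym (ts-col (f2 u) (f2T u (D-f u p cu)))) (trans (cong col (trans (sym (f-f u cu)) e)) cv))
    AU : A ⊆b U
    AU v p with ∨-elim {Ts v} p
    ... | inj₁ q = ∧-elimˡ {U v} (sT v q)
    ... | inj₂ q = ∧-elimˡ {U v} (∧-elimˡ {YU v} q)
    Ast : StableB A
    Ast = stable-∪ Ts Y1 (side-stable Ts true ts-col) (other-side-stable Y1 true (λ v p → not-intro (y1-col v p)))
            (λ u v p q a → true-false-absurd (nbhd-intro Ts u v p a) (not-elim (∧-elimʳ {YU v} q)))
    count : size D + size A ≡ size U
    count = trans (cong₂ _+_ (size-disjoint-∪ X1 X2 (λ i p q → true≢false (trans (sym (x1-col i p)) (x2-col i q))))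
                             (size-disjoint-∪ Ts Y1 (λ i p q → true≢false (trans (sym (ts-col i p)) (y1-col i q)))))
             (trans (regroup (size X1) (size X2) (size Ts) (size Y1))
               (trans (cong₂ _+_ (sym (size-⊆-split Ts XU sT))
                                 (trans (cong (_+ size Y1) (size-cong X2 (YU ∩b nbhd Ts) (λ i → BoolP.∧-comm (nbhd Ts i) (YU i))))
                                        (sym (size-split YU (nbhd Ts)))))
                      (sym (size-split U (side true)))))
      where
      regroup : ∀ a b c d → (a + b) + (c + d) ≡ (c + a) + (b + d)
      regroup = solve-∀
    result : KönigEgerváry U
    result = record { D = D ; f = f ; A = A ; DU = DU ; fU = fU ; fadj = fadj ; finj = finj ;
                     fdisj = fdisj ; AU = AU ; Ast = Ast ; count = count }

  könig-egerváry : ∀ U → KönigEgerváry U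
  könig-egerváry U = let (Ts , sT , hmax) = max-deficiency (U ∩b side true) (U ∖b side true) in
                     KönigConstruction.result U Ts sT hmax

  length-V : ∀ M → length (V M) ≡ length M + length M
  length-V [] = refl
  length-V ((u , v) ∷ M) = cong suc (trans (cong suc (length-V M)) (sym (+-suc (length M) (length M))))

  nbhd-of-empty : ∀ S → size S ≡ 0 → ∀ y → nbhd S y ≡ true → ⊥
  nbhd-of-empty S c y p = let (u , su , _) = nbhd-elim S y p in true-false-absurd su (size≡0⇒empty S c u)

  Ψ⇒size-nbhd≤ : ∀ S → Ψᵇ S → size (nbhd S) ≤ size S
  Ψ⇒size-nbhd≤ S ps = subst₂ _≤_ (cong (_+ size (nbhd S)) (size-∅ {n}))
                         (trans (cong (size S +_) (size-empty (nbhd (∅b {n})) (λ y → nbhd-false ∅b y (λ u ())))) (+-identityʳ (size S)))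
                 (Ψ⇒MinSurplus S ps ∅b (λ i ()))

  -- Accessibility removes some x with S - x ∈ Ψ, still with |N(S - x)| = |S - x|; so
  -- exactly one y0 ∈ N(S) loses all its neighbours, and every matching sends y0 to x.
  module GreedoidUniqueness (gr : IsGreedoid (Ψ G)) where
    matched-to-removed : ∀ S x ψ → NbhdMatching S ψ → ∀ y → nbhd S y ≡ true → nbhd (S -b x) y ≡ false → ψ y ≡ x
    matched-to-removed S x ψ (mt , ad , ij) y p q with eqF (ψ y) x in e
    ... | true = eqF⇒≡ e
    ... | false = ⊥-elim (true-false-absurd (nbhd-intro (S -b x) (ψ y) y (∧-intro (mt y p) (not-intro e)) (adj-sym′ y (ψ y) (ad y p))) q)

    NbhdMatching-remove : ∀ S x ψ y0 → NbhdMatching S ψ → nbhd S y0 ≡ true → nbhd (S -b x) y0 ≡ false → ψ y0 ≡ x → NbhdMatching (S -b x) ψ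
    NbhdMatching-remove S x ψ y0 (mt , ad , ij) p0 q0 e0 = mt' , ad' , ij'
      where
      sub : (S -b x) ⊆b S
      sub i p = ∧-elimˡ {S i} p
      mt' : MapsTo (nbhd (S -b x)) ψ (S -b x)
      mt' y p = ∧-intro (mt y (nbhd-mono (S -b x) S sub y p))
                    (not-intro (≢⇒eqF-false (λ e → true-false-absurd p (subst (λ z → nbhd (S -b x) z ≡ false)
                       (sym (ij y y0 (nbhd-mono (S -b x) S sub y p) p0 (trans e (sym e0)))) q0))))
      ad' : ∀ y → nbhd (S -b x) y ≡ true → adj G y (ψ y) ≡ true
      ad' y p = ad y (nbhd-mono (S -b x) S sub y p)
      ij' : InjectiveOn (nbhd (S -b x)) ψ
      ij' i j p q r = ij i j (nbhd-mono (S -b x) S sub i p) (nbhd-mono (S -b x) S sub j q) r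

    nbhd-matching-unique : ∀ k S → size S ≤ k → Ψᵇ S → size (nbhd S) ≡ size S → ∀ ψ1 ψ2 → NbhdMatching S ψ1 → NbhdMatching S ψ2 →
            ∀ y → nbhd S y ≡ true → ψ1 y ≡ ψ2 y
    nbhd-matching-unique zero S le ps c ψ1 ψ2 m1 m2 y p = ⊥-elim (nbhd-of-empty S (n≤0⇒n≡0 le) y p)
    nbhd-matching-unique (suc k) S le ps c ψ1 ψ2 m1 m2 y p = fin (true-or-false (nbhd S' y))
      where
      u0 = nbhd-elim S y p
      ac = Ψᵇ-accessible gr S ps (proj₁ u0 , proj₁ (proj₂ u0))
      x = proj₁ ac
      sx = proj₁ (proj₂ ac)
      S' = S -b x
      ps' : Ψᵇ S'
      ps' = proj₂ (proj₂ ac)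
      sub : S' ⊆b S
      sub i q = ∧-elimˡ {S i} q
      e1 : size S ≡ suc (size S')
      e1 = size-remove S x sx
      d1 : size S' + size (nbhd S) ≤ size S + size (nbhd S')
      d1 = Ψ⇒MinSurplus S ps S' sub
      d2 : size (nbhd S') ≤ size S'
      d2 = Ψ⇒size-nbhd≤ S' ps'
      c' : size (nbhd S') ≡ size S'
      c' = ≤-antisym d2 (+-cancelʳ-≤ (size S) (size S') (size (nbhd S'))
             (subst₂ _≤_ (cong (size S' +_) c) (+-comm (size S) (size (nbhd S'))) d1))
      lt : size (nbhd S') < size (nbhd S)
      lt = subst₂ _<_ (sym c') (trans (sym e1) (sym c)) (n<1+n (size S'))
      fd = size<⇒extra (nbhd S') (nbhd S) (nbhd-mono S' S sub) lt
      y0 = proj₁ fd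
      p0 = proj₁ (proj₂ fd)
      q0 = proj₂ (proj₂ fd)
      h1 = matched-to-removed S x ψ1 m1 y0 p0 q0
      h2 = matched-to-removed S x ψ2 m2 y0 p0 q0
      ih = nbhd-matching-unique k S' (≤-pred (subst (_≤ suc k) e1 le)) ps' c' ψ1 ψ2
             (NbhdMatching-remove S x ψ1 y0 m1 p0 q0 h1) (NbhdMatching-remove S x ψ2 y0 m2 p0 q0 h2)
      fin : nbhd S' y ≡ true ⊎ nbhd S' y ≡ false → ψ1 y ≡ ψ2 y
      fin (inj₁ q) = ih y q
      fin (inj₂ q) = trans (matched-to-removed S x ψ1 m1 y p q) (sym (matched-to-removed S x ψ2 m2 y p q))

  edge-transfer : ∀ (A : BSet n) → StableB A → ∀ M1 M2 → IsMatching G M1 → IsMatching G M2 →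
             (∀ v → A v ≡ false → v ∈ V M2) → (∀ v → A v ≡ false → partner M1 v ≡ partner M2 v) →
             ∀ a b → (a , b) ∈ M1 → (a , b) ∈ M2 ⊎ (b , a) ∈ M2
  edge-transfer A stA M1 M2 im1 im2 cov2 peq a b m = go (true-or-false (A a))
    where
    pe = partner-edge M1 (proj₂ im1) a b m
    go : A a ≡ true ⊎ A a ≡ false → (a , b) ∈ M2 ⊎ (b , a) ∈ M2
    go (inj₁ aa) = fin (partner-∈ M2 (proj₂ im2) b (cov2 b ab))
      where
      ab : A b ≡ false
      ab with A b in e
      ... | false = refl
      ... | true = ⊥-elim (true≢false (trans (sym (edge-adj M1 im1 a b m)) (stA a b aa e)))
      q : partner M2 b ≡ a
      q = trans (sym (peq b ab)) (proj₂ pe)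
      fin : (b , partner M2 b) ∈ M2 ⊎ (partner M2 b , b) ∈ M2 → (a , b) ∈ M2 ⊎ (b , a) ∈ M2
      fin (inj₁ r) = inj₂ (subst (λ z → (b , z) ∈ M2) q r)
      fin (inj₂ r) = inj₁ (subst (λ z → (z , b) ∈ M2) q r)
    go (inj₂ aa) = fin (partner-∈ M2 (proj₂ im2) a (cov2 a aa))
      where
      q : partner M2 a ≡ b
      q = trans (sym (peq a aa)) (proj₁ pe)
      fin : (a , partner M2 a) ∈ M2 ⊎ (partner M2 a , a) ∈ M2 → (a , b) ∈ M2 ⊎ (b , a) ∈ M2
      fin (inj₁ r) = inj₁ (subst (λ z → (a , z) ∈ M2) q r)
      fin (inj₂ r) = inj₂ (subst (λ z → (z , a) ∈ M2) q r)

  EdgeIn-transfer : ∀ (A : BSet n) → StableB A → ∀ M1 M2 → IsMatching G M1 → IsMatching G M2 →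
             (∀ v → A v ≡ false → v ∈ V M2) → (∀ v → A v ≡ false → partner M1 v ≡ partner M2 v) →
             ∀ u v → EdgeIn G (u , v) M1 → EdgeIn G (u , v) M2
  EdgeIn-transfer A stA M1 M2 im1 im2 cov2 peq u v (inj₁ m) with edge-transfer A stA M1 M2 im1 im2 cov2 peq u v m
  ... | inj₁ r = inj₁ r
  ... | inj₂ r = inj₂ r
  EdgeIn-transfer A stA M1 M2 im1 im2 cov2 peq u v (inj₂ m) with edge-transfer A stA M1 M2 im1 im2 cov2 peq v u m
  ... | inj₁ r = inj₂ r
  ... | inj₂ r = inj₁ r

  -- With A the König-Egerváry stable set and M balanced against it, S = A ∩ V(M) lies
  -- in Ψ, N(S) = V ∖ A and M matches N(S) onto S; by GreedoidUniqueness every matching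
  -- with the vertex set of M pairs N(S) with S in the same way, so it has M's edges.
  module FromKönigCover (gr : IsGreedoid (Ψ G)) (A : BSet n) (stA : StableB A) (M : List (Fin n × Fin n))
             (im : IsMatching G M) (eqM : length M + size A ≡ n) where
    module K1 = Balanced M A im stA eqM

    S : BSet n
    S = A ∩b fromList (V M)

    partner∈A : ∀ M' → IsMatching G M' → (∀ u v → (u , v) ∈ M' → A u ≡ true ⊎ A v ≡ true) →
          ∀ v → A v ≡ false → v ∈ V M' → A (partner M' v) ≡ true
    partner∈A M' im' eo v av m with partner-∈ M' (proj₂ im') v m
    ... | inj₁ r with eo v (partner M' v) r
    ... | inj₁ q = ⊥-elim (true≢false (trans (sym q) av))
    ... | inj₂ q = q
    partner∈A M' im' eo v av m | inj₂ r with eo (partner M' v) v r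
    ... | inj₁ q = q
    ... | inj₂ q = ⊥-elim (true≢false (trans (sym q) av))

    partner∈S : ∀ v → A v ≡ false → S (partner M v) ≡ true
    partner∈S v av = ∧-intro (partner∈A M im K1.edge-meets v av (K1.covers v av))
                          (fromList⁺ (V M) (partner M v) (partner-endpoint M (proj₂ im) v (K1.covers v av)))

    nbhd-S⇒∉A : ∀ v → nbhd S v ≡ true → A v ≡ false
    nbhd-S⇒∉A v p with A v in e
    ... | false = refl
    ... | true = let (u , su , a) = nbhd-elim S v p in ⊥-elim (true≢false (trans (sym a) (stA u v (∧-elimˡ {A u} su) e)))

    ∉A⇒nbhd-S : ∀ v → A v ≡ false → nbhd S v ≡ true
    ∉A⇒nbhd-S v av = nbhd-intro S (partner M v) v (partner∈S v av) (adj-sym′ v (partner M v) (partner-adj M im v (K1.covers v av)))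

    stS : StableB S
    stS = stable-⊆ S A (λ i p → ∧-elimˡ {A i} p) stA

    M-matches : NbhdMatching S (partner M)
    M-matches = (λ y p → partner∈S y (nbhd-S⇒∉A y p)) ,
          (λ y p → partner-adj M im y (K1.covers y (nbhd-S⇒∉A y p))) ,
          (λ i j p q r → partner-injective M (proj₂ im) i j (K1.covers i (nbhd-S⇒∉A i p)) (K1.covers j (nbhd-S⇒∉A j q)) r)

    S∈Ψ : Ψᵇ S
    S∈Ψ = matched-nbhd⇒Ψ S (partner M) stS M-matches

    S⊆V : ∀ s → S s ≡ true → s ∈ V M
    S⊆V s p = fromList⁻ (V M) s (∧-elimʳ {A s} p)

    size-nbhd-S : size (nbhd S) ≡ size S
    size-nbhd-S = ≤-antisym (Ψ⇒size-nbhd≤ S S∈Ψ) (injection⇒size≤ S (nbhd S) (partner M) mp ij)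
      where
      mp : MapsTo S (partner M) (nbhd S)
      mp s p = ∉A⇒nbhd-S (partner M s) (lem (true-or-false (A (partner M s))))
        where
        lem : A (partner M s) ≡ true ⊎ A (partner M s) ≡ false → A (partner M s) ≡ false
        lem (inj₂ q) = q
        lem (inj₁ q) = ⊥-elim (true≢false (trans (sym (partner-adj M im s (S⊆V s p))) (stA s (partner M s) (∧-elimˡ {A s} p) q)))
      ij : InjectiveOn S (partner M)
      ij i j p q r = partner-injective M (proj₂ im) i j (S⊆V i p) (S⊆V j q) r

    module Rival (M' : List (Fin n × Fin n)) (im' : IsMatching G M')
                 (sameV : ∀ v → (v ∈ V M') ⇔ (v ∈ V M)) (eqM' : length M' + size A ≡ n) where
      module K2 = Balanced M' A im' stA eqM'

      M'-matches : NbhdMatching S (partner M')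
      M'-matches = (λ y p → ∧-intro (partner∈A M' im' K2.edge-meets y (nbhd-S⇒∉A y p) (K2.covers y (nbhd-S⇒∉A y p)))
                         (fromList⁺ (V M) (partner M' y) (Equivalence.to (sameV (partner M' y)) (partner-endpoint M' (proj₂ im') y (K2.covers y (nbhd-S⇒∉A y p)))))) ,
             (λ y p → partner-adj M' im' y (K2.covers y (nbhd-S⇒∉A y p))) ,
             (λ i j p q r → partner-injective M' (proj₂ im') i j (K2.covers i (nbhd-S⇒∉A i p)) (K2.covers j (nbhd-S⇒∉A j q)) r)

      same-partner : ∀ v → A v ≡ false → partner M v ≡ partner M' v
      same-partner v av = GreedoidUniqueness.nbhd-matching-unique gr (size S) S ≤-refl S∈Ψ size-nbhd-S (partner M) (partner M') M-matches M'-matches v (∉A⇒nbhd-S v av)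

      same-edges : SameEdgeSet G M' M
      same-edges u v = mk⇔ (EdgeIn-transfer A stA M' M im' im K1.covers (λ w aw → sym (same-partner w aw)) u v)
                     (EdgeIn-transfer A stA M M' im im' K2.covers same-partner u v)

  private
    module KE = KönigEgerváry (könig-egerváry fullb)

  maximum⇒balanced : ∀ M → IsMaximumMatching G M → length M + size KE.A ≡ n
  maximum⇒balanced M (im , mx) = ≤-antisym (matching+stable≤n M KE.A im KE.Ast)
    (subst (_≤ length M + size KE.A) (trans KE.count size-full)
      (+-monoˡ-≤ (size KE.A) (subst (_≤ length M) (length-toMatching KE.D KE.f) (mx L₀ L₀-isMatching))))
    where
    L₀ = toMatching KE.D KE.f
    L₀-isMatching : IsMatching G L₀
    L₀-isMatching = toMatching-isMatching KE.D KE.f KE.fadj KE.finj KE.fdisj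

  same-vertices⇒balanced : ∀ A M M' → StableB A → IsMatching G M → IsMatching G M' → (∀ v → (v ∈ V M') ⇔ (v ∈ V M)) →
                           length M + size A ≡ n → length M' + size A ≡ n
  same-vertices⇒balanced A M M' stA im im' sameV bal =
    ≤-antisym (matching+stable≤n M' A im' stA) (subst (_≤ length M' + size A) bal (+-monoˡ-≤ (size A) le))
    where
    le : length M ≤ length M'
    le = +-double-cancel-≤ (length M) (length M') (subst₂ _≤_ (length-V M) (length-V M')
           (≤-trans (unique-list-size≤ (V M) (fromList (V M')) (proj₂ im)
                      (AllM.tabulate (λ {v} m → fromList⁺ (V M') v (Equivalence.from (sameV v) m))))
                    (size-fromList≤ (V M'))))

  greedoid⇒UR : IsGreedoid (Ψ G) → ∀ M → IsMaximumMatching G M → UniquelyRestricted G M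
  greedoid⇒UR gr M max = proj₁ max , λ M' im' sameV →
    FromKönigCover.Rival.same-edges gr KE.A KE.Ast M (proj₁ max) bal M' im' sameV
      (same-vertices⇒balanced KE.A M M' KE.Ast (proj₁ max) im' sameV bal)
    where
    bal = maximum⇒balanced M max

  HallCondition-cong : ∀ X X' Y Y' → X ≐ X' → Y ≐ Y' → HallCondition X Y → HallCondition X' Y'
  HallCondition-cong X X' Y Y' ex ey hc T s = subst (size T ≤_) (size-cong _ _ (λ v → cong (nbhd T v ∧_) (ey v)))
                                    (hc T (λ i p → trans (ex i) (s i p)))

  MinSurplus⇒HallCondition : ∀ S Y → Y ⊆b S → MinSurplus S → HallCondition (nbhd S ∖b nbhd Y) (S ∖b Y)
  MinSurplus⇒HallCondition S Y sYS dc B sB = subst (size B ≤_) (size-cong _ _ (λ i → BoolP.∧-comm (T i) (nbhd B i)))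
      (cancel (size Y) (size R) (size (nbhd S)) (size (T ∩b nbhd B)) (size (nbhd YR)) (size B)
        (subst₂ _≤_ (cong (_+ size (nbhd S)) eYR) (cong (_+ size (nbhd YR)) (trans (size-⊆-split Y S sYS) (cong (size Y +_) (size-split T (nbhd B)))))
           (dc YR sub))
        k1)
    where
    cancel : ∀ y r ns tb nyr b → (y + r) + ns ≤ (y + (tb + r)) + nyr → nyr + b ≤ ns → b ≤ tb
    cancel y r ns tb nyr b h k = +-cancelʳ-≤ nyr b tb
      (subst (_≤ tb + nyr) (+-comm nyr b)
        (≤-trans k (+-cancelˡ-≤ (y + r) ns (tb + nyr) (subst ((y + r) + ns ≤_) (swap y tb r nyr) h))))
      where
      swap : ∀ y tb r nyr → (y + (tb + r)) + nyr ≡ (y + r) + (tb + nyr)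
      swap = solve-∀
    T = S ∖b Y
    R = T ∖b nbhd B
    YR = Y ∪b R
    sub : YR ⊆b S
    sub i p with ∨-elim {Y i} p
    ... | inj₁ q = sYS i q
    ... | inj₂ q = ∧-elimˡ {S i} (∧-elimˡ {T i} q)
    eYR : size YR ≡ size Y + size R
    eYR = size-disjoint-∪ Y R (λ i p q → true-false-absurd p (not-elim (∧-elimʳ {S i} (∧-elimˡ {T i} q))))
    k1 : size (nbhd YR) + size B ≤ size (nbhd S)
    k1 = subst (_≤ size (nbhd S)) (size-disjoint-∪ (nbhd YR) B d) (size-mono _ _ s2)
      where
      d : ∀ i → nbhd YR i ≡ true → B i ≡ true → ⊥
      d i p q with nbhd-elim YR i p
      ... | (u , uyr , a) with ∨-elim {Y u} uyr
      ... | inj₁ yu = true-false-absurd (nbhd-intro Y u i yu a) (not-elim (∧-elimʳ {nbhd S i} (sB i q)))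
      ... | inj₂ ru = true-false-absurd (nbhd-intro B i u q (adj-sym′ u i a)) (not-elim (∧-elimʳ {T u} ru))
      s2 : (nbhd YR ∪b B) ⊆b nbhd S
      s2 i p with ∨-elim {nbhd YR i} p
      ... | inj₁ q = nbhd-mono YR S sub i q
      ... | inj₂ q = ∧-elimˡ {nbhd S i} (sB i q)

  AllMaxUR : Set
  AllMaxUR = ∀ M → IsMaximumMatching G M → UniquelyRestricted G M

  -- Extended by a König-Egerváry cover of G - N[S], both F and F' become maximum
  -- matchings with the same vertex set, so AllMaxUR forces them to coincide.
  module GlueMaximum (ur : AllMaxUR) (S : BSet n) (stS : StableB S) (F F' : Fin n → Fin n) (mF : NbhdMatching S F) (mF' : NbhdMatching S F')
                (img1 : ∀ v → nbhd S v ≡ true → ∃ λ w → nbhd S w ≡ true × F w ≡ F' v)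
                (img2 : ∀ v → nbhd S v ≡ true → ∃ λ w → nbhd S w ≡ true × F' w ≡ F v)
                (K : KönigEgerváry (∁b (S ∪b nbhd S))) where
    U = ∁b (S ∪b nbhd S)
    DR = KönigEgerváry.D K
    fR = KönigEgerváry.f K
    AR = KönigEgerváry.A K
    D = nbhd S ∪b DR

    U⇒∉S : ∀ v → U v ≡ true → S v ≡ false
    U⇒∉S v p with true-or-false (S v)
    ... | inj₂ q = q
    ... | inj₁ q = ⊥-elim (true≢false (trans (sym (∨-introˡ {S v} {nbhd S v} q)) (not-elim p)))
    U⇒∉nbhd : ∀ v → U v ≡ true → nbhd S v ≡ false
    U⇒∉nbhd v p with true-or-false (nbhd S v)
    ... | inj₂ q = q
    ... | inj₁ q = ⊥-elim (true≢false (trans (sym (∨-introʳ {S v} {nbhd S v} q)) (not-elim p)))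

    comb : (Fin n → Fin n) → Fin n → Fin n
    comb F₀ = piecewise (nbhd S) F₀ fR

    comb-t : ∀ F₀ v → nbhd S v ≡ true → comb F₀ v ≡ F₀ v
    comb-t F₀ v p = piecewise-true (nbhd S) F₀ fR v p
    comb-f : ∀ F₀ v → nbhd S v ≡ false → comb F₀ v ≡ fR v
    comb-f F₀ v p = piecewise-false (nbhd S) F₀ fR v p

    D-R : ∀ v → D v ≡ true → nbhd S v ≡ false → DR v ≡ true
    D-R v p q with ∨-elim {nbhd S v} p
    ... | inj₁ r = ⊥-elim (true≢false (trans (sym r) q))
    ... | inj₂ r = r

    D-S : ∀ v → D v ≡ true → S v ≡ false
    D-S v p with ∨-elim {nbhd S v} p
    ... | inj₁ r = stable-nbhd-outside S v stS r
    ... | inj₂ r = U⇒∉S v (KönigEgerváry.DU K v r)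

    module Glued (F₀ : Fin n → Fin n) (m₀ : NbhdMatching S F₀) where
      cadj : ∀ v → D v ≡ true → adj G v (comb F₀ v) ≡ true
      cadj v p with true-or-false (nbhd S v)
      ... | inj₁ q = subst (λ z → adj G v z ≡ true) (sym (comb-t F₀ v q)) (proj₁ (proj₂ m₀) v q)
      ... | inj₂ q = subst (λ z → adj G v z ≡ true) (sym (comb-f F₀ v q)) (KönigEgerváry.fadj K v (D-R v p q))
      cinj : InjectiveOn D (comb F₀)
      cinj u v p q e with true-or-false (nbhd S u) | true-or-false (nbhd S v)
      ... | inj₁ a | inj₁ b = proj₂ (proj₂ m₀) u v a b (trans (sym (comb-t F₀ u a)) (trans e (comb-t F₀ v b)))
      ... | inj₂ a | inj₂ b = KönigEgerváry.finj K u v (D-R u p a) (D-R v q b) (trans (sym (comb-f F₀ u a)) (trans e (comb-f F₀ v b)))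
      ... | inj₁ a | inj₂ b = ⊥-elim (true-false-absurd (proj₁ m₀ u a) (subst (λ z → S z ≡ false)
                                 (sym (trans (sym (comb-t F₀ u a)) (trans e (comb-f F₀ v b)))) (U⇒∉S (fR v) (KönigEgerváry.fU K v (D-R v q b)))))
      ... | inj₂ a | inj₁ b = ⊥-elim (true-false-absurd (proj₁ m₀ v b) (subst (λ z → S z ≡ false)
                                 (trans (sym (comb-f F₀ u a)) (trans e (comb-t F₀ v b))) (U⇒∉S (fR u) (KönigEgerváry.fU K u (D-R u p a)))))
      cdisj : ∀ u v → D u ≡ true → D v ≡ true → comb F₀ u ≡ v → ⊥
      cdisj u v p q e with true-or-false (nbhd S u)
      ... | inj₁ a = true-false-absurd (subst (λ z → S z ≡ true) (trans (sym (comb-t F₀ u a)) e) (proj₁ m₀ u a)) (D-S v q)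
      ... | inj₂ a with true-or-false (nbhd S v)
      ... | inj₁ b = true-false-absurd b (U⇒∉nbhd v (subst (λ z → U z ≡ true) (trans (sym (comb-f F₀ u a)) e) (KönigEgerváry.fU K u (D-R u p a))))
      ... | inj₂ b = KönigEgerváry.fdisj K u v (D-R u p a) (D-R v q b) (trans (sym (comb-f F₀ u a)) e)
      L = toMatching D (comb F₀)
      imL : IsMatching G L
      imL = toMatching-isMatching D (comb F₀) cadj cinj cdisj

    module C1 = Glued F mF
    module C2 = Glued F' mF'

    A = S ∪b AR
    stA : StableB A
    stA = stable-∪ S AR stS (KönigEgerváry.Ast K)
            (λ u v p q a → true-false-absurd (nbhd-intro S u v p a) (U⇒∉nbhd v (KönigEgerváry.AU K v q)))

    countDA : size D + size A ≡ n
    countDA = trans (cong₂ _+_ (size-disjoint-∪ (nbhd S) DR (λ i p q → true-false-absurd p (U⇒∉nbhd i (KönigEgerváry.DU K i q))))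
                               (size-disjoint-∪ S AR (λ i p q → true-false-absurd p (U⇒∉S i (KönigEgerváry.AU K i q)))))
              (trans (eqx (size (nbhd S)) (size DR) (size S) (size AR))
                 (trans (cong₂ _+_ (sym (size-disjoint-∪ S (nbhd S) (λ i p q → true-false-absurd p (stable-nbhd-outside S i stS q)))) (KönigEgerváry.count K))
                        (size-complement (S ∪b nbhd S))))
      where
      eqx : ∀ a b c d → (a + b) + (c + d) ≡ (c + a) + (b + d)
      eqx = solve-∀

    maxL : IsMaximumMatching G C1.L
    maxL = C1.imL , λ M'' im'' → subst (length M'' ≤_) (sym (length-toMatching D (comb F)))
             (+-cancelʳ-≤ (size A) (length M'') (size D) (subst (length M'' + size A ≤_) (sym countDA) (matching+stable≤n M'' A im'' stA)))

    saturated-⊆ : ∀ F₁ F₂ → (∀ v → nbhd S v ≡ true → ∃ λ w → nbhd S w ≡ true × F₁ w ≡ F₂ v) →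
          ∀ x → x ∈ V (toMatching D (comb F₂)) → x ∈ V (toMatching D (comb F₁))
    saturated-⊆ F₁ F₂ img x m with graph-endpoint⁻ (comb F₂) (elements D) x m
    ... | (v , mv , inj₁ refl) = proj₁ (graph-endpoint⁺ (comb F₁) (elements D) v mv)
    ... | (v , mv , inj₂ refl) with true-or-false (nbhd S v)
    ... | inj₂ b = subst (_∈ V (toMatching D (comb F₁))) (trans (comb-f F₁ v b) (sym (comb-f F₂ v b)))
                     (proj₂ (graph-endpoint⁺ (comb F₁) (elements D) v mv))
    ... | inj₁ b = let (w , nw , ew) = img v b in
                   subst (_∈ V (toMatching D (comb F₁))) (trans (comb-t F₁ w nw) (trans ew (sym (comb-t F₂ v b))))
                     (proj₂ (graph-endpoint⁺ (comb F₁) (elements D) w (elements⁺ D w (∨-introˡ nw))))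

    same : SameEdgeSet G C2.L C1.L
    same = proj₂ (ur C1.L maxL) C2.L C2.imL (λ x → mk⇔ (saturated-⊆ F F' img1 x) (saturated-⊆ F' F img2 x))

    result : ∀ v → nbhd S v ≡ true → F v ≡ F' v
    result v p with Equivalence.to (same v (comb F' v)) (inj₁ (∈-graph⁺ (comb F') (elements D) v (elements⁺ D v (∨-introˡ p))))
    ... | inj₁ r = trans (sym (comb-t F v p)) (trans (sym (proj₂ (∈-graph⁻ (comb F) (elements D) v (comb F' v) r))) (comb-t F' v p))
    ... | inj₂ r = ⊥-elim (true-false-absurd (subst (λ z → S z ≡ true) (sym (comb-t F' v p)) (proj₁ mF' v p))
                     (D-S (comb F' v) (elements⁻ D (comb F' v) (proj₁ (∈-graph⁻ (comb F) (elements D) (comb F' v) v r)))))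

  UR⇒nbhd-matching-unique : AllMaxUR → ∀ S → StableB S → ∀ F F' → NbhdMatching S F → NbhdMatching S F' →
          (∀ v → nbhd S v ≡ true → ∃ λ w → nbhd S w ≡ true × F w ≡ F' v) →
          (∀ v → nbhd S v ≡ true → ∃ λ w → nbhd S w ≡ true × F' w ≡ F v) →
          ∀ v → nbhd S v ≡ true → F v ≡ F' v
  UR⇒nbhd-matching-unique ur S stS F F' mF mF' img1 img2 = GlueMaximum.result ur S stS F F' mF mF' img1 img2 (könig-egerváry (∁b (S ∪b nbhd S)))

  nbhd-∅ : ∀ v → nbhd (∅b {n}) v ≡ false
  nbhd-∅ v = nbhd-false ∅b v (λ u ())

  Ψ⇒HallCondition-nbhd : ∀ Y → Ψᵇ Y → HallCondition (nbhd Y) Y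
  Ψ⇒HallCondition-nbhd Y psY = HallCondition-cong (nbhd Y ∖b nbhd ∅b) (nbhd Y) (Y ∖b ∅b) Y
                (λ v → trans (cong (λ z → nbhd Y v ∧ not z) (nbhd-∅ v)) (BoolP.∧-identityʳ (nbhd Y v)))
                (λ v → BoolP.∧-identityʳ (Y v))
                (MinSurplus⇒HallCondition Y ∅b (λ i ()) (Ψ⇒MinSurplus Y psY))

  -- fY and fP glue to a matching of N(S) into S; S - x stays in Ψ whenever this
  -- matching avoids x ∈ S ∖ Y. That happens if fP misses x, or if x = fP p is the only
  -- neighbour of p in S ∖ Y. Otherwise every p has a second neighbour there, and a
  -- second fP (AlternativeMatching) contradicts the uniqueness under AllMaxUR.
  module Shrink (ur : AllMaxUR) (S Y : BSet n) (psS : Ψᵇ S) (psY : Ψᵇ Y) (sYS : Y ⊆b S)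
                (nonempty : ∃ λ x → (S ∖b Y) x ≡ true)
                (fP : Fin n → Fin n) (mP : MatchingInto (nbhd S ∖b nbhd Y) (S ∖b Y) fP)
                (fY : Fin n → Fin n) (mY : MatchingInto (nbhd Y) Y fY) where
    T = S ∖b Y
    P = nbhd S ∖b nbhd Y
    stS = proj₁ psS

    comb : (Fin n → Fin n) → Fin n → Fin n
    comb g = piecewise (nbhd Y) fY g
    comb-t : ∀ g v → nbhd Y v ≡ true → comb g v ≡ fY v
    comb-t g v p = piecewise-true (nbhd Y) fY g v p
    comb-f : ∀ g v → nbhd Y v ≡ false → comb g v ≡ g v
    comb-f g v p = piecewise-false (nbhd Y) fY g v p

    inP : ∀ v → nbhd S v ≡ true → nbhd Y v ≡ false → P v ≡ true
    inP v p q = ∧-intro p (not-intro q)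
    P-NB : ∀ v → P v ≡ true → nbhd S v ≡ true
    P-NB v p = ∧-elimˡ {nbhd S v} p
    P-nY : ∀ v → P v ≡ true → nbhd Y v ≡ false
    P-nY v p = not-elim (∧-elimʳ {nbhd S v} p)
    T-S : ∀ v → T v ≡ true → S v ≡ true
    T-S v p = ∧-elimˡ {S v} p
    T-nY : ∀ v → T v ≡ true → Y v ≡ false
    T-nY v p = not-elim (∧-elimʳ {S v} p)

    glued-NbhdMatching : ∀ g → MatchingInto P T g → NbhdMatching S (comb g)
    glued-NbhdMatching g (mg , ag , ig) = mt , ad , ij
      where
      mt : MapsTo (nbhd S) (comb g) S
      mt v p with true-or-false (nbhd Y v)
      ... | inj₁ q = subst (λ z → S z ≡ true) (sym (comb-t g v q)) (sYS (fY v) (proj₁ mY v q))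
      ... | inj₂ q = subst (λ z → S z ≡ true) (sym (comb-f g v q)) (T-S (g v) (mg v (inP v p q)))
      ad : ∀ v → nbhd S v ≡ true → adj G v (comb g v) ≡ true
      ad v p with true-or-false (nbhd Y v)
      ... | inj₁ q = subst (λ z → adj G v z ≡ true) (sym (comb-t g v q)) (proj₁ (proj₂ mY) v q)
      ... | inj₂ q = subst (λ z → adj G v z ≡ true) (sym (comb-f g v q)) (ag v (inP v p q))
      ij : InjectiveOn (nbhd S) (comb g)
      ij u v p q e with true-or-false (nbhd Y u) | true-or-false (nbhd Y v)
      ... | inj₁ a | inj₁ b = proj₂ (proj₂ mY) u v a b (trans (sym (comb-t g u a)) (trans e (comb-t g v b)))
      ... | inj₂ a | inj₂ b = ig u v (inP u p a) (inP v q b) (trans (sym (comb-f g u a)) (trans e (comb-f g v b)))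
      ... | inj₁ a | inj₂ b = ⊥-elim (true-false-absurd (proj₁ mY u a) (subst (λ z → Y z ≡ false)
                                 (sym (trans (sym (comb-t g u a)) (trans e (comb-f g v b)))) (T-nY (g v) (mg v (inP v q b)))))
      ... | inj₂ a | inj₁ b = ⊥-elim (true-false-absurd (proj₁ mY v b) (subst (λ z → Y z ≡ false)
                                 (trans (sym (comb-f g u a)) (trans e (comb-t g v b))) (T-nY (g u) (mg u (inP u p a)))))

    mF = glued-NbhdMatching fP mP

    avoided⇒Ψ-remove : ∀ x → (∀ v → nbhd (S -b x) v ≡ true → ¬ comb fP v ≡ x) → Ψᵇ (S -b x)
    avoided⇒Ψ-remove x avoid = matched-nbhd⇒Ψ (S -b x) (comb fP) (stable-⊆ (S -b x) S sub stS) (mt , ad , ij)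
      where
      sub : (S -b x) ⊆b S
      sub i p = ∧-elimˡ {S i} p
      mt : MapsTo (nbhd (S -b x)) (comb fP) (S -b x)
      mt v p = ∧-intro (proj₁ mF v (nbhd-mono (S -b x) S sub v p)) (not-intro (≢⇒eqF-false (avoid v p)))
      ad : ∀ v → nbhd (S -b x) v ≡ true → adj G v (comb fP v) ≡ true
      ad v p = proj₁ (proj₂ mF) v (nbhd-mono (S -b x) S sub v p)
      ij : InjectiveOn (nbhd (S -b x)) (comb fP)
      ij u v p q e = proj₂ (proj₂ mF) u v (nbhd-mono (S -b x) S sub u p) (nbhd-mono (S -b x) S sub v q) e

    Result = ∃ λ x → T x ≡ true × Ψᵇ (S -b x)

    caseA : size P < size T → Result
    caseA lt with FinP.any? (λ x → (T x BoolP.≟ true) ×-dec ¬? (hit? P fP x))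
    ... | yes (x , tx , nh) = x , tx , avoided⇒Ψ-remove x avoid
      where
      avoid : ∀ v → nbhd (S -b x) v ≡ true → ¬ comb fP v ≡ x
      avoid v p e with true-or-false (nbhd Y v)
      ... | inj₁ q = true-false-absurd (proj₁ mY v q) (subst (λ z → Y z ≡ false) (sym (trans (sym (comb-t fP v q)) e)) (T-nY x tx))
      ... | inj₂ q = nh (v , inP v (nbhd-mono (S -b x) S (λ i r → ∧-elimˡ {S i} r) v p) q , trans (sym (comb-f fP v q)) e)
    ... | no nh = ⊥-elim (<-irrefl refl (≤-trans lt (onto⇒size≤ P T fP onto)))
      where
      onto : ∀ t → T t ≡ true → ∃ λ p → P p ≡ true × fP p ≡ t
      onto t tt with hit? P fP t
      ... | yes h = h
      ... | no nh' = ⊥-elim (nh (t , tt , nh'))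

    Only : Fin n → Set
    Only p = ∀ t → T t ≡ true → adj G p t ≡ true → t ≡ fP p

    only? : ∀ p → Dec (Only p)
    only? p = FinP.all? (λ t → (T t BoolP.≟ true) →-dec ((adj G p t BoolP.≟ true) →-dec (t FinP.≟ fP p)))

    caseB-yes : ∀ p → P p ≡ true → Only p → Result
    caseB-yes p pp only = x , proj₁ mP p pp , avoided⇒Ψ-remove x avoid
      where
      x = fP p
      p∉ : nbhd (S -b x) p ≡ true → ⊥
      p∉ q with nbhd-elim (S -b x) p q
      ... | (u , su , a) with true-or-false (Y u)
      ... | inj₁ yu = true-false-absurd (nbhd-intro Y u p yu a) (P-nY p pp)
      ... | inj₂ yu = true-false-absurd (subst (λ z → eqF u z ≡ true) (only u (∧-intro (∧-elimˡ {S u} su) (not-intro yu)) (adj-sym′ u p a)) (eqF-refl u))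
                              (not-elim (∧-elimʳ {S u} su))
      avoid : ∀ v → nbhd (S -b x) v ≡ true → ¬ comb fP v ≡ x
      avoid v q e with true-or-false (nbhd Y v)
      ... | inj₁ r = true-false-absurd (proj₁ mY v r) (subst (λ z → Y z ≡ false) (sym (trans (sym (comb-t fP v r)) e)) (T-nY x (proj₁ mP p pp)))
      ... | inj₂ r = p∉ (subst (λ z → nbhd (S -b x) z ≡ true)
                      (proj₂ (proj₂ mP) v p (inP v (nbhd-mono (S -b x) S (λ i w → ∧-elimˡ {S i} w) v q) r) pp (trans (sym (comb-f fP v r)) e)) q)

    caseB-no : size T ≤ size P → (∀ p → P p ≡ true → Only p → ⊥) → ⊥
    caseB-no leT none = contra (another-matching (size P) P T fP ≤-refl mP leT oth neP)
      where
      oth : ∀ p → P p ≡ true → ∃ λ t → T t ≡ true × adj G p t ≡ true × ¬ t ≡ fP p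
      oth p pp with FinP.any? (λ t → (T t BoolP.≟ true) ×-dec ((adj G p t BoolP.≟ true) ×-dec ¬? (t FinP.≟ fP p)))
      ... | yes r = r
      ... | no nr = ⊥-elim (none p pp only)
        where
        only : Only p
        only t tt a with t FinP.≟ fP p
        ... | yes e = e
        ... | no ne = ⊥-elim (nr (t , tt , a , ne))
      neP : ∃ λ p → P p ≡ true
      neP = size>0⇒nonempty P (≤-trans (subst (0 <_) (sym (size-remove T (proj₁ nonempty) (proj₂ nonempty))) (s≤s z≤n)) leT)
      contra : AnotherMatching P T fP → ⊥
      contra (f'P , mP' , p0 , pp0 , ne0) = ne0 (sym (trans (sym (comb-f fP p0 (P-nY p0 pp0)))
                 (trans (UR⇒nbhd-matching-unique ur S stS (comb fP) (comb f'P) mF (glued-NbhdMatching f'P mP') img1 img2 p0 (P-NB p0 pp0))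
                        (comb-f f'P p0 (P-nY p0 pp0)))))
        where
        imgG : ∀ g h → MatchingInto P T g → MatchingInto P T h → ∀ v → nbhd S v ≡ true → ∃ λ w → nbhd S w ≡ true × comb g w ≡ comb h v
        imgG g h (mg , ag , ig) (mh , ah , ih) v p with true-or-false (nbhd Y v)
        ... | inj₁ q = v , p , trans (comb-t g v q) (sym (comb-t h v q))
        ... | inj₂ q = let (w , pw , ew) = injection-onto P T g mg ig leT (h v) (mh v (inP v p q)) in
                       w , P-NB w pw , trans (comb-f g w (P-nY w pw)) (trans ew (sym (comb-f h v q)))
        img1 = imgG fP f'P mP mP'
        img2 = imgG f'P fP mP' mP

    result : Result
    result with size T ≤? size P
    ... | no gt = caseA (≰⇒> gt)
    ... | yes leT with FinP.any? (λ p → (P p BoolP.≟ true) ×-dec only? p)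
    ... | yes (p , pp , only) = caseB-yes p pp only
    ... | no none = ⊥-elim (caseB-no leT (λ p pp o → none (p , pp , o)))

  Ψ-shrink : AllMaxUR → ∀ S Y → Ψᵇ S → Ψᵇ Y → Y ⊆b S → (∃ λ x → (S ∖b Y) x ≡ true) →
       ∃ λ x → (S ∖b Y) x ≡ true × Ψᵇ (S -b x)
  Ψ-shrink ur S Y psS psY sYS ne = Shrink.result ur S Y psS psY sYS ne (proj₁ hP) (proj₂ hP) (proj₁ hY) (proj₂ hY)
    where
    hP = hall (nbhd S ∖b nbhd Y) (S ∖b Y) (MinSurplus⇒HallCondition S Y sYS (Ψ⇒MinSurplus S psS))
    hY = hall (nbhd Y) Y (Ψ⇒HallCondition-nbhd Y psY)

  module Descend (ur : AllMaxUR) (Y X : BSet n) (psY : Ψᵇ Y) where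
    Extension = ∃ λ x → X x ≡ true × Y x ≡ false × Ψᵇ (Y ∪b ⁅ x ⁆b)

    descend-last : ∀ S → Ψᵇ S → Y ⊆b S → size (S ∖b Y) ≡ 1 → (S ∖b Y) ⊆b X → ∀ x → (S ∖b Y) x ≡ true → Extension
    descend-last S psS sYS c1 sX x sx = x , sX x sx , not-elim (∧-elimʳ {S x} sx) , Ψᵇ-cong S (Y ∪b ⁅ x ⁆b) eqS psS
      where
      eqS : ∀ v → S v ≡ (Y ∪b ⁅ x ⁆b) v
      eqS v with true-or-false (S v) | true-or-false (Y v)
      ... | inj₁ s | inj₁ y = trans s (sym (∨-introˡ y))
      ... | inj₁ s | inj₂ y = trans s (sym (∨-introʳ {Y v} (subst (λ z → eqF z x ≡ true) (sym (size≡1⇒unique (S ∖b Y) x v c1 sx (∧-intro s (not-intro y)))) (eqF-refl x))))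
      ... | inj₂ s | inj₁ y = ⊥-elim (true≢false (trans (sym (sYS v y)) s))
      ... | inj₂ s | inj₂ y = trans s (sym (cong₂ _∨_ y (≢⇒eqF-false (λ e → true≢false (trans (sym (∧-elimˡ {S x} sx)) (subst (λ z → S z ≡ false) e s))))))

    descend : ∀ k S → size (S ∖b Y) ≤ k → Ψᵇ S → Y ⊆b S → 0 < size (S ∖b Y) → (S ∖b Y) ⊆b X → Extension
    descend zero S le psS sYS pos sX = ⊥-elim (<-irrefl refl (≤-trans pos le))
    descend (suc k) S le psS sYS pos sX = go (size (S ∖b Y) ≟ 1)
      where
      go : Dec (size (S ∖b Y) ≡ 1) → Extension
      go (yes c1) = let (x , sx) = size>0⇒nonempty (S ∖b Y) pos in descend-last S psS sYS c1 sX x sx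
      go (no c≠1) = descend k S' le' (proj₂ (proj₂ ra)) sYS' pos' sX'
        where
        ra = Ψ-shrink ur S Y psS psY sYS (size>0⇒nonempty (S ∖b Y) pos)
        x = proj₁ ra
        sx = proj₁ (proj₂ ra)
        S' = S -b x
        ∖-remove-comm : ∀ v → (S' ∖b Y) v ≡ ((S ∖b Y) -b x) v
        ∖-remove-comm v = ∧-xy∙z≈xz∙y (S v) (not (eqF v x)) (not (Y v))
        cS : size (S ∖b Y) ≡ suc (size ((S ∖b Y) -b x))
        cS = size-remove (S ∖b Y) x sx
        cS' : size (S' ∖b Y) ≡ size ((S ∖b Y) -b x)
        cS' = size-cong _ _ ∖-remove-comm
        le' : size (S' ∖b Y) ≤ k
        le' = subst (_≤ k) (sym cS') (≤-pred (subst (_≤ suc k) cS le))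
        pos' : 0 < size (S' ∖b Y)
        pos' = subst (0 <_) (sym cS') (lem (size ((S ∖b Y) -b x)) cS)
          where
          lem : ∀ m → size (S ∖b Y) ≡ suc m → 0 < m
          lem zero e = ⊥-elim (c≠1 e)
          lem (suc m) e = s≤s z≤n
        sYS' : Y ⊆b S'
        sYS' v yv = ∧-intro (sYS v yv) (not-intro (≢⇒eqF-false (λ e → true≢false (trans (sym (subst (λ z → Y z ≡ true) e yv)) (not-elim (∧-elimʳ {S x} sx))))))
        sX' : (S' ∖b Y) ⊆b X
        sX' v p = sX v (∧-elimˡ {(S ∖b Y) v} (trans (sym (∖-remove-comm v)) p))

  -- X' = X ∖ N[Y] is nonempty, as |X| > |Y| and |X ∩ N(Y)| ≤ |Y ∩ N(X)|. For a nonempty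
  -- T0 ⊆ X' of maximal deficiency with respect to V ∖ N(Y), Y ∪ T0 has minimal surplus,
  -- so it lies in Ψ, and Descend shrinks it to some Y ∪ {x}.
  module Exchange (ur : AllMaxUR) (X Y : BSet n) (psX : Ψᵇ X) (psY : Ψᵇ Y) (eq : size X ≡ suc (size Y)) where
    stX = proj₁ psX
    stY = proj₁ psY
    NY = nbhd Y
    NX = nbhd X
    X' = X ∖b (Y ∪b NY)
    X'-X : X' ⊆b X
    X'-X v p = ∧-elimˡ {X v} p
    X'-nY : ∀ v → X' v ≡ true → Y v ≡ false
    X'-nY v p with true-or-false (Y v)
    ... | inj₂ q = q
    ... | inj₁ q = ⊥-elim (true≢false (trans (sym (∨-introˡ {Y v} {NY v} q)) (not-elim (∧-elimʳ {X v} p))))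
    X'-nNY : ∀ v → X' v ≡ true → NY v ≡ false
    X'-nNY v p with true-or-false (NY v)
    ... | inj₂ q = q
    ... | inj₁ q = ⊥-elim (true≢false (trans (sym (∨-introʳ {Y v} {NY v} q)) (not-elim (∧-elimʳ {X v} p))))

    crossing-≤ : size (X ∩b NY) ≤ size (Y ∩b NX)
    crossing-≤ = +-cancelʳ-≤ (size (Y ∖b NX)) (size (X ∩b NY)) (size (Y ∩b NX))
             (subst₂ _≤_ (size-disjoint-∪ (X ∩b NY) (Y ∖b NX) d) (size-split Y NX) (proj₂ psY B' stB inB))
      where
      B' = (X ∩b NY) ∪b (Y ∖b NX)
      d : ∀ i → (X ∩b NY) i ≡ true → (Y ∖b NX) i ≡ true → ⊥
      d i p q = true-false-absurd (∧-elimˡ {Y i} q) (stable-nbhd-outside Y i stY (∧-elimʳ {X i} p))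
      stB : StableB B'
      stB = stable-∪ (X ∩b NY) (Y ∖b NX) (stable-⊆ _ X (λ i p → ∧-elimˡ {X i} p) stX) (stable-⊆ _ Y (λ i p → ∧-elimˡ {Y i} p) stY)
              (λ u v p q a → true-false-absurd (nbhd-intro X u v (∧-elimˡ {X u} p) a) (not-elim (∧-elimʳ {Y v} q)))
      inB : ∀ v → B' v ≡ true → InClosedNbhdᵇ Y v
      inB v p with ∨-elim {(X ∩b NY) v} p
      ... | inj₁ q = let (u , yu , a) = nbhd-elim Y v (∧-elimʳ {X v} q) in inj₂ (u , yu , a)
      ... | inj₂ q = inj₁ (∧-elimˡ {Y v} q)

    X-partition : size X ≡ (size (X ∩b Y) + size (X ∩b NY)) + size X'
    X-partition = trans (size-split X (Y ∪b NY))
              (cong (_+ size X') (trans (size-cong _ _ (λ i → BoolP.∧-distribˡ-∨ (X i) (Y i) (NY i)))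
                 (size-disjoint-∪ (X ∩b Y) (X ∩b NY) (λ i p q → true-false-absurd (∧-elimʳ {X i} p) (stable-nbhd-outside Y i stY (∧-elimʳ {X i} q))))))

    Y-parts≤ : size (X ∩b Y) + size (Y ∩b NX) ≤ size Y
    Y-parts≤ = subst (_≤ size Y) (size-disjoint-∪ (X ∩b Y) (Y ∩b NX) (λ i p q → true-false-absurd (∧-elimˡ {X i} p) (stable-nbhd-outside X i stX (∧-elimʳ {Y i} q))))
              (size-mono _ Y (λ i p → lem i (∨-elim {(X ∩b Y) i} p)))
      where
      lem : ∀ i → (X ∩b Y) i ≡ true ⊎ (Y ∩b NX) i ≡ true → Y i ≡ true
      lem i (inj₁ q) = ∧-elimʳ {X i} q
      lem i (inj₂ q) = ∧-elimˡ {Y i} q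

    X'-nonempty : 0 < size X'
    X'-nonempty = +-cancelˡ-≤ (size Y) 1 (size X')
           (subst (_≤ size Y + size X') (+-comm 1 (size Y))
             (≤-trans (≤-reflexive (trans (sym eq) X-partition))
               (+-monoˡ-≤ (size X') (≤-trans (+-monoʳ-≤ (size (X ∩b Y)) crossing-≤) Y-parts≤))))

    nbhd-X'-side : Bool → BSet n
    nbhd-X'-side b = (nbhd X' ∖b NY) ∩b side b

    module SideWitness (b : Bool) where
      B1 = Y ∩b NX
      B2 = X ∩b Y
      B3 = X' ∩b side b
      B4 = nbhd-X'-side b
      B = B1 ∪b (B2 ∪b (B3 ∪b B4))
      q-nNY : ∀ v → B4 v ≡ true → NY v ≡ false
      q-nNY v p = not-elim (∧-elimʳ {nbhd X' v} (∧-elimˡ {(nbhd X' ∖b NY) v} p))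
      q-NX' : ∀ v → B4 v ≡ true → nbhd X' v ≡ true
      q-NX' v p = ∧-elimˡ {nbhd X' v} (∧-elimˡ {(nbhd X' ∖b NY) v} p)
      q-col : ∀ v → B4 v ≡ true → side b v ≡ true
      q-col v p = ∧-elimʳ {(nbhd X' ∖b NY) v} p
      q-nX : ∀ v → B4 v ≡ true → X v ≡ false
      q-nX v p = stable-nbhd-outside X v stX (nbhd-mono X' X X'-X v (q-NX' v p))
      st34 : StableB (B3 ∪b B4)
      st34 = stable-∪ B3 B4 (stable-⊆ B3 X (λ i p → X'-X i (∧-elimˡ {X' i} p)) stX) (side-stable B4 b q-col)
               (λ u v p q a → true-false-absurd (q-col v q) (side-adj b u v a (∧-elimʳ {X' u} p)))
      st234 : StableB (B2 ∪b (B3 ∪b B4))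
      st234 = stable-∪ B2 (B3 ∪b B4) (stable-⊆ B2 X (λ i p → ∧-elimˡ {X i} p) stX) st34 cr
        where
        cr : ∀ u v → B2 u ≡ true → (B3 ∪b B4) v ≡ true → adj G u v ≡ true → ⊥
        cr u v p q a with ∨-elim {B3 v} q
        ... | inj₁ r = true≢false (trans (sym a) (stX u v (∧-elimˡ {X u} p) (X'-X v (∧-elimˡ {X' v} r))))
        ... | inj₂ r = true-false-absurd (nbhd-intro Y u v (∧-elimʳ {X u} p) a) (q-nNY v r)
      stB : StableB B
      stB = stable-∪ B1 (B2 ∪b (B3 ∪b B4)) (stable-⊆ B1 Y (λ i p → ∧-elimˡ {Y i} p) stY) st234 cr
        where
        cr : ∀ u v → B1 u ≡ true → (B2 ∪b (B3 ∪b B4)) v ≡ true → adj G u v ≡ true → ⊥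
        cr u v p q a with ∨-elim {B2 v} q
        ... | inj₁ r = true≢false (trans (sym a) (stY u v (∧-elimˡ {Y u} p) (∧-elimʳ {X v} r)))
        ... | inj₂ r with ∨-elim {B3 v} r
        ... | inj₁ r3 = true-false-absurd (nbhd-intro Y u v (∧-elimˡ {Y u} p) a) (X'-nNY v (∧-elimˡ {X' v} r3))
        ... | inj₂ r4 = true-false-absurd (nbhd-intro Y u v (∧-elimˡ {Y u} p) a) (q-nNY v r4)
      inB : ∀ v → B v ≡ true → InClosedNbhdᵇ X v
      inB v p with ∨-elim {B1 v} p
      ... | inj₁ q = let (u , xu , a) = nbhd-elim X v (∧-elimʳ {Y v} q) in inj₂ (u , xu , a)
      ... | inj₂ q with ∨-elim {B2 v} q
      ... | inj₁ r = inj₁ (∧-elimˡ {X v} r)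
      ... | inj₂ r with ∨-elim {B3 v} r
      ... | inj₁ r3 = inj₁ (X'-X v (∧-elimˡ {X' v} r3))
      ... | inj₂ r4 = let (u , xu , a) = nbhd-elim X' v (q-NX' v r4) in inj₂ (u , X'-X u xu , a)
      eB : size B ≡ size B1 + (size B2 + (size B3 + size B4))
      eB = trans (size-disjoint-∪ B1 _ d1) (cong (size B1 +_) (trans (size-disjoint-∪ B2 _ d2) (cong (size B2 +_) (size-disjoint-∪ B3 B4 d3))))
        where
        d3 : ∀ i → B3 i ≡ true → B4 i ≡ true → ⊥
        d3 i p q = true-false-absurd (X'-X i (∧-elimˡ {X' i} p)) (q-nX i q)
        d2 : ∀ i → B2 i ≡ true → (B3 ∪b B4) i ≡ true → ⊥
        d2 i p q with ∨-elim {B3 i} q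
        ... | inj₁ r = true-false-absurd (∧-elimʳ {X i} p) (X'-nY i (∧-elimˡ {X' i} r))
        ... | inj₂ r = true-false-absurd (∧-elimˡ {X i} p) (q-nX i r)
        d1 : ∀ i → B1 i ≡ true → (B2 ∪b (B3 ∪b B4)) i ≡ true → ⊥
        d1 i p q with ∨-elim {B2 i} q
        ... | inj₁ r = true-false-absurd (∧-elimˡ {X i} r) (stable-nbhd-outside X i stX (∧-elimʳ {Y i} p))
        ... | inj₂ r with ∨-elim {B3 i} r
        ... | inj₁ r3 = true-false-absurd (X'-X i (∧-elimˡ {X' i} r3)) (stable-nbhd-outside X i stX (∧-elimʳ {Y i} p))
        ... | inj₂ r4 = let (u , xu , a) = nbhd-elim X' i (q-NX' i r4) in
                        true-false-absurd (nbhd-intro Y i u (∧-elimˡ {Y i} p) (adj-sym′ u i a)) (X'-nNY u xu)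

    X'-surplus-side : ∀ b → size (nbhd-X'-side b) ≤ size (X' ∖b side b)
    X'-surplus-side b = cancel (size B1) (size B2) (size B3) (size B4) (size (X ∩b NY)) (size (X' ∖b side b))
                  (subst₂ _≤_ eB (trans X-partition (cong ((size (X ∩b Y) + size (X ∩b NY)) +_) (size-split X' (side b))))
                     (proj₂ psX B stB inB))
                  crossing-≤
      where
      open SideWitness b
      cancel : ∀ c a x q bb y → c + (a + (x + q)) ≤ (a + bb) + (x + y) → bb ≤ c → q ≤ y
      cancel c a x q bb y h le = +-cancelˡ-≤ x q y (+-cancelˡ-≤ (a + c) (x + q) (x + y)
        (subst (_≤ (a + c) + (x + y)) (regroup c a x q) (≤-trans h (+-monoˡ-≤ (x + y) (+-monoʳ-≤ a le)))))
        where
        regroup : ∀ c a x q → c + (a + (x + q)) ≡ (a + c) + (x + q)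
        regroup = solve-∀
    X'-surplus : size (nbhd X' ∖b NY) ≤ size X'
    X'-surplus = subst₂ _≤_ (sym (size-split (nbhd X' ∖b NY) (side true)))
           (trans (+-comm (size (X' ∖b side true)) (size (X' ∩b side true))) (sym (size-split X' (side true))))
           (+-mono-≤ (X'-surplus-side true) (subst (size (nbhd-X'-side false) ≤_)
               (size-cong _ _ (λ v → cong (X' v ∧_) (BoolP.not-involutive (col v)))) (X'-surplus-side false)))

    NonemptyMaximiser : Set
    NonemptyMaximiser = Σ (BSet n) λ T0 → T0 ⊆b X' × 0 < size T0 ×
            (∀ T → T ⊆b X' → size T + size (nbhd T0 ∖b NY) ≤ size T0 + size (nbhd T ∖b NY))

    -- If the deficiency maximiser is empty, X' itself (of deficiency ≥ 0 by X'-surplus) is one too.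
    nonempty-maximiser : ∀ Ts → Ts ⊆b X' →
                         (∀ T → T ⊆b X' → size T + size (nbhd Ts ∖b NY) ≤ size Ts + size (nbhd T ∖b NY)) → NonemptyMaximiser
    nonempty-maximiser Ts sT mx with size Ts ≟ 0
    ... | no nz = Ts , sT , n≢0⇒n>0 nz , mx
    ... | yes z = X' , (λ i p → p) , X'-nonempty , λ T s →
            subst (size T + size (nbhd X' ∖b NY) ≤_) (+-comm (size (nbhd T ∖b NY)) (size X'))
              (+-mono-≤ (≤-trans (m≤m+n (size T) _) (subst (λ z → size T + size (nbhd Ts ∖b NY) ≤ z + size (nbhd T ∖b NY)) z (mx T s)))
                        X'-surplus)

    module ViaMaximiser (T0 : BSet n) (sT0 : T0 ⊆b X') (pos0 : 0 < size T0)
                  (mx0 : ∀ T → T ⊆b X' → size T + size (nbhd T0 ∖b NY) ≤ size T0 + size (nbhd T ∖b NY)) where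
      YT = Y ∪b T0
      stYT : StableB YT
      stYT = stable-∪ Y T0 stY (stable-⊆ T0 X (λ i p → X'-X i (sT0 i p)) stX)
               (λ u v p q a → true-false-absurd (nbhd-intro Y u v p a) (X'-nNY v (sT0 v q)))
      YT-surplus : MinSurplus YT
      YT-surplus R sR = subst₂ _≤_ (cong (_+ size (nbhd YT)) (sym (size-split R Y))) (cong (_+ size (nbhd R)) (sym k3))
          (add-surplus (size (R ∩b Y)) (size (R ∖b Y)) (size (nbhd YT)) (size NY) (size (nbhd T0 ∖b NY)) (size Y)
               (size (nbhd (R ∩b Y))) (size T0) (size (nbhd (R ∖b Y) ∖b NY)) (size (nbhd R))
               k1 (Ψ⇒MinSurplus Y psY (R ∩b Y) (λ i p → ∧-elimʳ {R i} p)) (mx0 (R ∖b Y) sub) k2)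
        where
        add-surplus : ∀ ry rt nyt ny a y nry t0 b nr → nyt ≤ ny + a → ry + ny ≤ y + nry → rt + a ≤ t0 + b → nry + b ≤ nr →
                      (ry + rt) + nyt ≤ (y + t0) + nr
        add-surplus ry rt nyt ny a y nry t0 b nr h1 h2 h3 h4 =
          ≤-trans (+-monoʳ-≤ (ry + rt) h1)
            (subst (_≤ (y + t0) + nr) (sym (interchange ry rt ny a))
              (≤-trans (+-mono-≤ h2 h3) (subst (_≤ (y + t0) + nr) (sym (interchange y nry t0 b)) (+-monoʳ-≤ (y + t0) h4))))
        sub : (R ∖b Y) ⊆b X'
        sub v p with ∨-elim {Y v} (sR v (∧-elimˡ {R v} p))
        ... | inj₁ q = ⊥-elim (true-false-absurd q (not-elim (∧-elimʳ {R v} p)))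
        ... | inj₂ q = sT0 v q
        k1 : size (nbhd YT) ≤ size NY + size (nbhd T0 ∖b NY)
        k1 = ≤-trans (size-mono (nbhd YT) (NY ∪b (nbhd T0 ∖b NY)) inc) (size-∪-≤ NY (nbhd T0 ∖b NY))
          where
          inc : nbhd YT ⊆b (NY ∪b (nbhd T0 ∖b NY))
          inc v p with nbhd-elim YT v p
          ... | (u , yu , a) with ∨-elim {Y u} yu
          ... | inj₁ q = ∨-introˡ (nbhd-intro Y u v q a)
          ... | inj₂ q with true-or-false (NY v)
          ... | inj₁ r = ∨-introˡ r
          ... | inj₂ r = ∨-introʳ {NY v} (∧-intro (nbhd-intro T0 u v q a) (not-intro r))
        k2 : size (nbhd (R ∩b Y)) + size (nbhd (R ∖b Y) ∖b NY) ≤ size (nbhd R)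
        k2 = subst (_≤ size (nbhd R)) (size-disjoint-∪ (nbhd (R ∩b Y)) (nbhd (R ∖b Y) ∖b NY) d) (size-mono _ (nbhd R) inc)
          where
          d : ∀ i → nbhd (R ∩b Y) i ≡ true → (nbhd (R ∖b Y) ∖b NY) i ≡ true → ⊥
          d i p q = true-false-absurd (nbhd-mono (R ∩b Y) Y (λ j r → ∧-elimʳ {R j} r) i p) (not-elim (∧-elimʳ {nbhd (R ∖b Y) i} q))
          inc : (nbhd (R ∩b Y) ∪b (nbhd (R ∖b Y) ∖b NY)) ⊆b nbhd R
          inc i p with ∨-elim {nbhd (R ∩b Y) i} p
          ... | inj₁ q = nbhd-mono (R ∩b Y) R (λ j r → ∧-elimˡ {R j} r) i q
          ... | inj₂ q = nbhd-mono (R ∖b Y) R (λ j r → ∧-elimˡ {R j} r) i (∧-elimˡ {nbhd (R ∖b Y) i} q)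
        k3 : size YT ≡ size Y + size T0
        k3 = size-disjoint-∪ Y T0 (λ i p q → true-false-absurd p (X'-nY i (sT0 i q)))
      YT∈Ψ : Ψᵇ YT
      YT∈Ψ = MinSurplus⇒Ψ YT stYT YT-surplus
      result : ∃ λ x → X x ≡ true × Y x ≡ false × Ψᵇ (Y ∪b ⁅ x ⁆b)
      result = Descend.descend ur Y X psY (size (YT ∖b Y)) YT ≤-refl YT∈Ψ (λ i p → ∨-introˡ p) pos sub
        where
        pos : 0 < size (YT ∖b Y)
        pos = ≤-trans pos0 (size-mono T0 (YT ∖b Y) (λ i p → ∧-intro (∨-introʳ {Y i} p) (not-intro (X'-nY i (sT0 i p)))))
        sub : (YT ∖b Y) ⊆b X
        sub v p with ∨-elim {Y v} (∧-elimˡ {YT v} p)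
        ... | inj₁ q = ⊥-elim (true-false-absurd q (not-elim (∧-elimʳ {YT v} p)))
        ... | inj₂ q = X'-X v (sT0 v q)

    maximiser : NonemptyMaximiser
    maximiser = let (Ts , sT , mx) = max-deficiency X' (∁b NY) in nonempty-maximiser Ts sT mx

    result : ∃ λ x → X x ≡ true × Y x ≡ false × Ψᵇ (Y ∪b ⁅ x ⁆b)
    result = let (T0 , sT0 , pos0 , mx0) = maximiser in ViaMaximiser.result T0 sT0 pos0 mx0

  UR⇒greedoid : AllMaxUR → IsGreedoid (Ψ G)
  UR⇒greedoid ur = greedoid-from-Ψᵇ acc (λ X Y px py e → Exchange.result ur X Y px py e)
    where
    acc : ∀ A → Ψᵇ A → (∃ λ x → A x ≡ true) → ∃ λ x → A x ≡ true × Ψᵇ (A -b x)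
    acc A psA (x , ax) = let (y , sy , ps') = Ψ-shrink ur A ∅b psA Ψᵇ-∅ (λ i ()) (x , ∧-intro ax refl) in
                         y , ∧-elimˡ {A y} sy , ps'

theorem4 : (n : ℕ) (G : Graph n) → Bipartite G →
    IsGreedoid (Ψ G) ⇔
    (∀ (M : List (Fin n × Fin n)) → IsMaximumMatching G M → UniquelyRestricted G M)
theorem4 n G (colour , proper) =
  mk⇔ (BipartiteGraph.greedoid⇒UR G colour proper) (BipartiteGraph.UR⇒greedoid G colour proper)
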